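{- Let $G=(A\cup B,E)$ be a connected, reduced bipartite graph with partite sets $A=\{a_1,\dots,a_m\}$ and $B=\{b_1,\dots,b_n\}$, $m\le n$. If $m$ is odd, adjoin a new vertex $a_{m+1}$ to $A$ with $N(a_{m+1})=\varnothing$ and replace $m$ by $m+1$; so assume below that $m$ is even, and let $G'$ denote $G$ if $m$ was even and $G$ together with the isolated vertex $a_{m+1}$ if $m$ was odd. Group $A$ into the pairs $(a_1,a_2),(a_3,a_4),\dots,(a_{m-1},a_m)$. For each pair $(a_i,a_j)=(a_{2s-1},a_{2s})$, let $$w_{(i,j)} = B_{*i}\, a_i\, B_i\, a_j\, w'_{(i,j)}\, a_i\, B'_j\, a_j\, B'_{*j},$$ where $B_i$ is any permutation of $N(a_i)\setminus N(a_j)$, $w'_{(i,j)}$ is any permutation of $N(a_i)\cap N(a_j)$, $B'_j$ is any permutation of $N(a_j)\setminus N(a_i)$, and $B_{*i}B'_{*j}$ (concatenation) is any permutation of $B\setminus (N(a_i)\cup N(a_j))$. For $s=1,\dots,\frac m2$, let $D_s$ be the word obtained as follows: remove the pair $(a_{2s-1},a_{2s})$ and the next pair cyclically, i.e. $(a_{2s+1},a_{2s+2})$ if $s<\frac m2$ and $(a_1,a_2)$ if $s=\frac m2$; then $D_s$ is the word listing the second components $a_{2t}$ of the remaining pairs in increasing order of $t$, followed by the first components $a_{2t-1}$ of the remaining pairs in increasing order of $t$. Let $$w_0 = a_2\, a_1\, \bigl(w_{(1,2)}^R\bigr)|_B\, a_4\, a_3\, \cdots\, a_m\, a_{m-1},$$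 where $u^R$ denotes the reversal of a word $u$ and $u|_B$ the subword of $u$ consisting of the letters in $B$. Finally let $$w = w_{(1,2)}\, D_1\, w_{(3,4)}\, D_2\, w_{(5,6)}\, D_3 \cdots w_{(m-1,m)}\, D_{m/2}\, w_0 .$$ Then $w$ (a $(1+\frac m2)$-uniform word over the vertex set of $G'$) represents $G'$; i.e. for any two distinct vertices $x,y$ of $G'$, $x$ and $y$ are adjacent in $G'$ if and only if $x$ and $y$ alternate in $w$.
   Context: A word over a finite set is a finite sequence of its elements. For a word $w$ and a subset $S$, $w|_S$ is the subword obtained by deleting all letters not in $S$. Letters $x,y$ alternate in $w$ if $w|_{\{x,y\}}$ is of the form $xyxy\cdots$ or $yxyx\cdots$ (even or odd length). A word $w$ represents a graph if the vertices are exactly the letters of $w$ and two vertices are adjacent iff they alternate in $w$. A word is $k$-uniform if every letter occurs exactly $k$ times. $N(x)$ denotes the neighborhood of vertex $x$. A graph is reduced if no two vertices have the same neighborhood. The blocks $B_{*i},B_i,w'_{(i,j)},B'_j,B'_{*j}$ may be empty. -}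

module Defs where

open import Data.Nat using (ℕ; zero; suc; _<_; _*_; _<?_; _≡ᵇ_)
open import Data.Fin using (Fin; toℕ; fromℕ<; combine; _≟_)
open import Data.Fin as F using ()
open import Data.Bool using (Bool; true; false; not; _∧_; if_then_else_)
open import Data.Sum using (_⊎_; inj₁; inj₂)
open import Data.Sum.Properties using (≡-dec)
open import Data.Product using (_×_; _,_; ∃-syntax)
open import Data.Empty using (⊥)
open import Data.List using (List; []; _∷_; _++_; map; concat; reverse; filterᵇ; filter; length; upTo; allFin)
open import Data.List.Membership.Propositional using (_∈_)
open import Data.List.Relation.Unary.Unique.Propositional using (Unique)
open import Data.List.Relation.Binary.Permutation.Propositional using (_↭_)
open import Relation.Binary.PropositionalEquality using (_≡_; _≢_)
open import Relation.Binary.Construct.Closure.ReflexiveTransitive using (Star)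
open import Relation.Nullary using (¬_; yes; no; does)
open import Relation.Binary.Definitions using (DecidableEquality)
open import Function.Bundles using (_⇔_)

module _ {L : Set} (_≟L_ : DecidableEquality L) where

  restrict₂ : L → L → List L → List L
  restrict₂ x y = filterᵇ (λ c → does (c ≟L x) Data.Bool.∨ does (c ≟L y))

  altWord : L → L → ℕ → List L
  altWord x y zero    = []
  altWord x y (suc ℓ) = x ∷ altWord y x ℓ

  Alternate : L → L → List L → Set
  Alternate x y w = ∃[ ℓ ] (restrict₂ x y w ≡ altWord x y ℓ ⊎ restrict₂ x y w ≡ altWord y x ℓ)

  count : L → List L → ℕ
  count x w = length (filterᵇ (λ c → does (c ≟L x)) w)

  -- w represents the graph with vertex set L and adjacency Adj:
  -- the letters of w are exactly the vertices (every element of L occurs;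
  -- w can contain nothing else), and distinct x, y are adjacent iff they alternate.
  Represents : (L → L → Set) → List L → Set
  Represents Adj w = (∀ v → v ∈ w) × (∀ x y → x ≢ y → (Adj x y ⇔ Alternate x y w))

  Uniform : ℕ → List L → Set
  Uniform k w = ∀ v → count v w ≡ k

-- Bipartite graphs with partite sets A = Fin m, B = Fin n, given by
-- a biadjacency matrix E : Fin m → Fin n → Bool.
-- Vertices: Fin m ⊎ Fin n  (inj₁ i = a_{i+1}, inj₂ j = b_{j+1}).

Vertex : ℕ → ℕ → Set
Vertex m n = Fin m ⊎ Fin n

_≟V_ : ∀ {m n} → DecidableEquality (Vertex m n)
_≟V_ = ≡-dec _≟_ _≟_

BAdj : ∀ {m n} → (Fin m → Fin n → Bool) → Vertex m n → Vertex m n → Set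
BAdj E (inj₁ a) (inj₂ b) = E a b ≡ true
BAdj E (inj₂ b) (inj₁ a) = E a b ≡ true
BAdj E (inj₁ _) (inj₁ _) = ⊥
BAdj E (inj₂ _) (inj₂ _) = ⊥

Connected : ∀ {m n} → (Fin m → Fin n → Bool) → Set
Connected E = ∀ x y → Star (BAdj E) x y

Reduced : ∀ {m n} → (Fin m → Fin n → Bool) → Set
Reduced E = ∀ x y → (∀ z → BAdj E x z ⇔ BAdj E y z) → x ≡ y

-- G' : A extended to Fin (k * 2) (k = number of pairs); vertices with
-- index ≥ m (at most the one new vertex a_{m+1}) are isolated.

extend : ∀ {m n} (k : ℕ) → (Fin m → Fin n → Bool) → Fin (k * 2) → Fin n → Bool
extend {m} k E a b with toℕ a <? m
... | yes p = E (fromℕ< p) b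
... | no _  = false

-- the pair number s (0-based) is (a_{2s+1}, a_{2s+2}) in 1-based notation
fstA : ∀ {k} → Fin k → Fin (k * 2)
fstA s = combine s F.zero

sndA : ∀ {k} → Fin k → Fin (k * 2)
sndA s = combine s (F.suc F.zero)

-- The choice data for the block w_{(i,j)} of one pair (a_i , a_j):
--   w_{(i,j)} = B_{*i} a_i B_i a_j w'_{(i,j)} a_i B'_j a_j B'_{*j}

record PairData (n : ℕ) : Set where
  field
    Bstar  : List (Fin n)
    Bi     : List (Fin n)
    Wmid   : List (Fin n)
    Bj     : List (Fin n)
    Bstar' : List (Fin n)
open PairData public

IsPermOf : ∀ {n} → List (Fin n) → (Fin n → Set) → Set
IsPermOf l P = Unique l × (∀ b → b ∈ l ⇔ P b)

ValidPairData : ∀ {M n} → (Fin M → Fin n → Bool) → Fin M → Fin M → PairData n → Set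
ValidPairData E' ai aj d =
    IsPermOf (Bi d)   (λ b → E' ai b ≡ true  × E' aj b ≡ false)
  × IsPermOf (Wmid d) (λ b → E' ai b ≡ true  × E' aj b ≡ true)
  × IsPermOf (Bj d)   (λ b → E' ai b ≡ false × E' aj b ≡ true)
  × IsPermOf (Bstar d ++ Bstar' d) (λ b → E' ai b ≡ false × E' aj b ≡ false)

module Construction {k n : ℕ} (d : Fin k → PairData n) where

  Letter : Set
  Letter = Vertex (k * 2) n

  Bs : List (Fin n) → List Letter
  Bs = map inj₂

  aL : Fin (k * 2) → Letter
  aL = inj₁

  wPair : Fin k → List Letter
  wPair s = Bs (Bstar (d s)) ++ aL (fstA s) ∷ Bs (Bi (d s)) ++ aL (sndA s) ∷ Bs (Wmid (d s))
            ++ aL (fstA s) ∷ Bs (Bj (d s)) ++ aL (sndA s) ∷ Bs (Bstar' (d s))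

  nextIdx : Fin k → ℕ
  nextIdx s = if suc (toℕ s) ≡ᵇ k then 0 else suc (toℕ s)

  remaining : Fin k → List (Fin k)
  remaining s = filterᵇ (λ t → not (toℕ t ≡ᵇ toℕ s) ∧ not (toℕ t ≡ᵇ nextIdx s)) (allFin k)

  D : Fin k → List Letter
  D s = map (λ t → aL (sndA t)) (remaining s) ++ map (λ t → aL (fstA t)) (remaining s)

  isB : Letter → Bool
  isB (inj₁ _) = false
  isB (inj₂ _) = true

  restrictB : List Letter → List Letter
  restrictB = filterᵇ isB

  w0 : List Letter
  w0 with allFin k
  ... | []      = []
  ... | t ∷ ts  = aL (sndA t) ∷ aL (fstA t) ∷ restrictB (reverse (wPair t))
                  ++ concat (map (λ u → aL (sndA u) ∷ aL (fstA u) ∷ []) ts)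

  word : List Letter
  word = concat (map (λ s → wPair s ++ D s) (allFin k)) ++ w0

module Submission where

-- Restrict w to two letters. Let a be a letter of pair s (of k = m/2 pairs) and b ∈ B.
-- Every block w_(t) with t ≠ s contains b once and a not at all, D_t contains a unless t
-- is s or its cyclic predecessor, and w₀ contributes one a and one b. Hence w|_{a,b} is an
-- alternation of length 2(k+1) in which one factor a b a has been replaced by w_(s)|_{a,b},
-- and that factor is a b a if b ∈ N(a), and a a b or b a a otherwise; this gives both the
-- adjacency of a and b and the (k+1)-uniformity. For the two letters a, a′ of one pair,
-- w_(s)|_{a,a′} = a a′ a a′ and everything after it begins with a′. For letters of different
-- pairs, a occurs twice in its own block, which contains no letter of the other pair. For
-- b, b′ ∈ B, w|_{b,b′} has even length but begins and ends with the same letter, because w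
-- begins with w_(1,2) and w₀ ends with its reversal on B.

open import Defs
open import Data.Nat using (ℕ; zero; suc; _+_; _*_; _≤_; _<_; _≡ᵇ_; s≤s; z≤n)
import Data.Nat.Properties as ℕₚ
open ℕₚ using (+-suc; +-identityʳ; +-commutativeSemigroup; <⇒≢; m≤n⇒∃[o]m+o≡n; ≤-pred; 1+n≢0; 1+n≢n; m≤m+n)
open import Algebra.Properties.CommutativeSemigroup +-commutativeSemigroup using (x∙yz≈y∙xz)
open import Data.Nat.Tactic.RingSolver using (solve-∀)
open import Data.Fin using (Fin; zero; suc; toℕ; combine; remQuot)
import Data.Fin.Properties as Finₚ
open import Data.Bool using (Bool; true; false; T; not; _∨_; _∧_; if_then_else_)
import Data.Bool.Properties as Boolₚ
open Boolₚ using (∨-comm)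
open import Data.Sum using (_⊎_; inj₁; inj₂; swap)
open import Data.Sum.Properties using (inj₁-injective; inj₂-injective)
import Data.Sum as Sum
open import Data.Product using (_×_; _,_; ∃-syntax; proj₁; proj₂)
import Data.Product as Product
open import Data.Empty using (⊥; ⊥-elim)
open import Data.List using (List; []; _∷_; [_]; _++_; map; concat; reverse; replicate; filterᵇ; length; applyUpTo; tabulate; allFin)
open import Data.List.Properties using (filter-++; filter-≐; reverse-++; unfold-reverse; ∷ʳ-injectiveʳ; ++-assoc; ∷-injective; length-++; ++-identityʳ; map-∘; map-tabulate; length-reverse; concat-++; applyUpTo-∷ʳ)
open import Data.List.Membership.Propositional using (_∈_; _∉_)
open import Data.List.Membership.Propositional.Properties using (∈-filter⁻; ∈-map⁻; ∈-allFin; ∈-++⁻)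
open import Data.List.Relation.Unary.Unique.Propositional.Properties using (allFin⁺)
open import Data.List.Relation.Unary.Any using (here; there)
open import Data.List.Relation.Unary.All.Properties using (All¬⇒¬Any)
open import Data.Unit using (⊤; tt)
open import Data.List.Relation.Unary.Unique.Propositional using (Unique)
open import Data.List.Relation.Unary.AllPairs using ([]; _∷_)
open import Function using (_∘_; id)
open import Function.Bundles using (Equivalence; _⇔_; mk⇔)
open import Relation.Binary.Definitions using (DecidableEquality)
open import Relation.Binary.PropositionalEquality hiding ([_])
open ≡-Reasoning
open import Relation.Nullary using (¬_; Dec; does; yes; no; _×-dec_)
open import Relation.Nullary.Decidable using (T?; dec-true; dec-false; toSum)

⟦_⟧ : Bool → ℕ
⟦ β ⟧ = if β then 1 else 0

true-or-false : ∀ b → b ≡ true ⊎ b ≡ false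
true-or-false true  = inj₁ refl
true-or-false false = inj₂ refl

≡ᵇ-≡ : ∀ {m n} → m ≡ n → (m ≡ᵇ n) ≡ true
≡ᵇ-≡ {m} {n} = dec-true (m ℕₚ.≟ n)

≡ᵇ-≢ : ∀ {m n} → m ≢ n → (m ≡ᵇ n) ≡ false
≡ᵇ-≢ {m} {n} = dec-false (m ℕₚ.≟ n)

replicate-+-++ : ∀ {A : Set} m n (v : A) w → replicate m v ++ replicate n v ++ w ≡ replicate (m + n) v ++ w
replicate-+-++ zero    n v w = refl
replicate-+-++ (suc m) n v w = cong (v ∷_) (replicate-+-++ m n v w)

-- Filtering

module _ {A : Set} (p : A → Bool) where

  filterᵇ-accept : ∀ {x} xs → p x ≡ true → filterᵇ p (x ∷ xs) ≡ x ∷ filterᵇ p xs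
  filterᵇ-accept xs px rewrite px = refl

  filterᵇ-reject : ∀ {x} xs → p x ≡ false → filterᵇ p (x ∷ xs) ≡ filterᵇ p xs
  filterᵇ-reject xs px rewrite px = refl

  filterᵇ-++ : ∀ xs ys → filterᵇ p (xs ++ ys) ≡ filterᵇ p xs ++ filterᵇ p ys
  filterᵇ-++ = filter-++ (T? ∘ p)

  filterᵇ-concat : ∀ xss → filterᵇ p (concat xss) ≡ concat (map (filterᵇ p) xss)
  filterᵇ-concat []         = refl
  filterᵇ-concat (xs ∷ xss) = trans (filterᵇ-++ xs (concat xss)) (cong (filterᵇ p xs ++_) (filterᵇ-concat xss))

  filterᵇ-reverse : ∀ xs → filterᵇ p (reverse xs) ≡ reverse (filterᵇ p xs)
  filterᵇ-reverse []       = refl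
  filterᵇ-reverse (x ∷ xs) = begin
    filterᵇ p (reverse (x ∷ xs))                       ≡⟨ cong (filterᵇ p) (unfold-reverse x xs) ⟩
    filterᵇ p (reverse xs ++ [ x ])                    ≡⟨ filterᵇ-++ (reverse xs) [ x ] ⟩
    filterᵇ p (reverse xs) ++ filterᵇ p [ x ]          ≡⟨ cong₂ _++_ (filterᵇ-reverse xs) (sym (reverse-filterᵇ-[ x ])) ⟩
    reverse (filterᵇ p xs) ++ reverse (filterᵇ p [ x ]) ≡⟨ reverse-++ (filterᵇ p [ x ]) (filterᵇ p xs) ⟨
    reverse (filterᵇ p [ x ] ++ filterᵇ p xs)          ≡⟨ cong reverse (filterᵇ-++ [ x ] xs) ⟨
    reverse (filterᵇ p (x ∷ xs))                       ∎
    where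
    reverse-filterᵇ-[_] : ∀ x → reverse (filterᵇ p [ x ]) ≡ filterᵇ p [ x ]
    reverse-filterᵇ-[ x ] with p x
    ... | true  = refl
    ... | false = refl

module _ {A : Set} (p q : A → Bool) where

  filterᵇ-cong : (∀ x → p x ≡ q x) → ∀ xs → filterᵇ p xs ≡ filterᵇ q xs
  filterᵇ-cong p≗q = filter-≐ (T? ∘ p) (T? ∘ q) ((λ {x} → subst T (p≗q x)) , (λ {x} → subst T (sym (p≗q x))))


  filterᵇ-filterᵇ : (∀ x → p x ≡ true → q x ≡ true) → ∀ xs → filterᵇ p (filterᵇ q xs) ≡ filterᵇ p xs
  filterᵇ-filterᵇ p⇒q []       = refl
  filterᵇ-filterᵇ p⇒q (x ∷ xs) with true-or-false (p x) | true-or-false (q x)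
  ... | inj₁ px | inj₁ qx = begin
    filterᵇ p (filterᵇ q (x ∷ xs)) ≡⟨ cong (filterᵇ p) (filterᵇ-accept q xs qx) ⟩
    filterᵇ p (x ∷ filterᵇ q xs)   ≡⟨ filterᵇ-accept p _ px ⟩
    x ∷ filterᵇ p (filterᵇ q xs)   ≡⟨ cong (x ∷_) (filterᵇ-filterᵇ p⇒q xs) ⟩
    x ∷ filterᵇ p xs               ≡⟨ filterᵇ-accept p xs px ⟨
    filterᵇ p (x ∷ xs)             ∎
  ... | inj₁ px | inj₂ qx with () ← trans (sym (p⇒q x px)) qx
  ... | inj₂ px | inj₁ qx = begin
    filterᵇ p (filterᵇ q (x ∷ xs)) ≡⟨ cong (filterᵇ p) (filterᵇ-accept q xs qx) ⟩
    filterᵇ p (x ∷ filterᵇ q xs)   ≡⟨ filterᵇ-reject p _ px ⟩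
    filterᵇ p (filterᵇ q xs)       ≡⟨ filterᵇ-filterᵇ p⇒q xs ⟩
    filterᵇ p xs                   ≡⟨ filterᵇ-reject p xs px ⟨
    filterᵇ p (x ∷ xs)             ∎
  ... | inj₂ px | inj₂ qx = begin
    filterᵇ p (filterᵇ q (x ∷ xs)) ≡⟨ cong (filterᵇ p) (filterᵇ-reject q xs qx) ⟩
    filterᵇ p (filterᵇ q xs)       ≡⟨ filterᵇ-filterᵇ p⇒q xs ⟩
    filterᵇ p xs                   ≡⟨ filterᵇ-reject p xs px ⟨
    filterᵇ p (x ∷ xs)             ∎

-- Concatenation of indexed blocks

applyUpTo-++ : ∀ {A : Set} (f : ℕ → A) m n → applyUpTo f (m + n) ≡ applyUpTo f m ++ applyUpTo (λ u → f (m + u)) n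
applyUpTo-++ f zero    n = refl
applyUpTo-++ f (suc m) n = cong (f 0 ∷_) (applyUpTo-++ (f ∘ suc) m n)

concat-applyUpTo-+ : ∀ {A : Set} (f : ℕ → List A) m n → concat (applyUpTo f (m + n)) ≡ concat (applyUpTo f m) ++ concat (applyUpTo (λ u → f (m + u)) n)
concat-applyUpTo-+ f m n = trans (cong concat (applyUpTo-++ f m n)) (sym (concat-++ (applyUpTo f m) _))

concat-applyUpTo-suc : ∀ {A : Set} (f : ℕ → List A) m → concat (applyUpTo f (suc m)) ≡ concat (applyUpTo f m) ++ f m
concat-applyUpTo-suc f m = begin
  concat (applyUpTo f (suc m))             ≡⟨ cong concat (applyUpTo-∷ʳ f m) ⟨
  concat (applyUpTo f m ++ [ f m ])        ≡⟨ concat-++ (applyUpTo f m) [ f m ] ⟨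
  concat (applyUpTo f m) ++ (f m ++ [])    ≡⟨ cong (concat (applyUpTo f m) ++_) (++-identityʳ (f m)) ⟩
  concat (applyUpTo f m) ++ f m            ∎

tabulate-toℕ : ∀ {A : Set} {k} (g : Fin k → A) (h : ℕ → A) → (∀ t → g t ≡ h (toℕ t)) → tabulate g ≡ applyUpTo h k
tabulate-toℕ {k = zero}  g h g≗h = refl
tabulate-toℕ {k = suc k} g h g≗h = cong₂ _∷_ (g≗h zero) (tabulate-toℕ (g ∘ suc) (h ∘ suc) (g≗h ∘ suc))

module _ {A : Set} (P : List A → Set) (P-[] : P []) (P-++ : ∀ {u v} → P u → P v → P (u ++ v)) where

  concat-tabulate⁺ : ∀ {k} (h : Fin k → List A) → (∀ t → P (h t)) → P (concat (tabulate h))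
  concat-tabulate⁺ {zero}  h Ph = P-[]
  concat-tabulate⁺ {suc k} h Ph = P-++ (Ph zero) (concat-tabulate⁺ (h ∘ suc) (Ph ∘ suc))

  concat-tabulate-split : ∀ {k} (h : Fin k → List A) s → (∀ t → t ≢ s → P (h t)) →
                          ∃[ Pre ] ∃[ Post ] P Pre × P Post × concat (tabulate h) ≡ Pre ++ h s ++ Post
  concat-tabulate-split h zero    Ph = [] , _ , P-[] , concat-tabulate⁺ (h ∘ suc) (λ t → Ph (suc t) λ ()) , refl
  concat-tabulate-split h (suc s) Ph with concat-tabulate-split (h ∘ suc) s (λ t t≢s → Ph (suc t) (t≢s ∘ Finₚ.suc-injective))
  ... | Pre , Post , P-Pre , P-Post , eq =
    h zero ++ Pre , Post , P-++ (Ph zero λ ()) P-Pre , P-Post , trans (cong (h zero ++_) eq) (sym (++-assoc (h zero) Pre _))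

module _ {A : Set} {k} (h : Fin k → List A) where

  concat-tabulate-[] : (∀ t → h t ≡ []) → concat (tabulate h) ≡ []
  concat-tabulate-[] = concat-tabulate⁺ (_≡ []) refl (λ { refl refl → refl }) h

  concat-tabulate-single : ∀ s → (∀ t → t ≢ s → h t ≡ []) → concat (tabulate h) ≡ h s
  concat-tabulate-single s h≡[] with concat-tabulate-split (_≡ []) refl (λ { refl refl → refl }) h s h≡[]
  ... | _ , _ , refl , refl , eq = trans eq (++-identityʳ (h s))

-- Words

module Words {L : Set} (_≟_ : DecidableEquality L) where

  ≟-refl : ∀ x → does (x ≟ x) ≡ true
  ≟-refl x = dec-true (x ≟ x) refl

  ≟-≢ : ∀ {x y} → x ≢ y → does (x ≟ y) ≡ false
  ≟-≢ = dec-false (_ ≟ _)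

  ≟-true⇒≡ : ∀ {x y} → does (x ≟ y) ≡ true → x ≡ y
  ≟-true⇒≡ {x} {y} eq with toSum (x ≟ y)
  ... | inj₁ x≡y = x≡y
  ... | inj₂ x≢y with () ← trans (sym eq) (≟-≢ x≢y)

  restrict₂-++ : ∀ x y u v → restrict₂ _≟_ x y (u ++ v) ≡ restrict₂ _≟_ x y u ++ restrict₂ _≟_ x y v
  restrict₂-++ x y = filterᵇ-++ _

  restrict₂-keepˡ : ∀ x y w → restrict₂ _≟_ x y (x ∷ w) ≡ x ∷ restrict₂ _≟_ x y w
  restrict₂-keepˡ x y w = filterᵇ-accept _ w (cong (_∨ does (x ≟ y)) (≟-refl x))

  restrict₂-keepʳ : ∀ x y w → restrict₂ _≟_ x y (y ∷ w) ≡ y ∷ restrict₂ _≟_ x y w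
  restrict₂-keepʳ x y w = filterᵇ-accept _ w (trans (∨-comm (does (y ≟ x)) _) (cong (_∨ does (y ≟ x)) (≟-refl y)))

  restrict₂-drop : ∀ {x y c} w → c ≢ x → c ≢ y → restrict₂ _≟_ x y (c ∷ w) ≡ restrict₂ _≟_ x y w
  restrict₂-drop w c≢x c≢y = filterᵇ-reject _ w (cong₂ _∨_ (≟-≢ c≢x) (≟-≢ c≢y))

  restrict₂-comm : ∀ x y w → restrict₂ _≟_ x y w ≡ restrict₂ _≟_ y x w
  restrict₂-comm x y = filterᵇ-cong _ _ (λ c → ∨-comm (does (c ≟ x)) (does (c ≟ y)))

  count-++ : ∀ x u v → count _≟_ x (u ++ v) ≡ count _≟_ x u + count _≟_ x v
  count-++ x u v = trans (cong length (filterᵇ-++ _ u v)) (length-++ (filterᵇ _ u))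

  count-here : ∀ x w → count _≟_ x (x ∷ w) ≡ suc (count _≟_ x w)
  count-here x w = cong length (filterᵇ-accept _ w (≟-refl x))

  count-there : ∀ {x c} w → c ≢ x → count _≟_ x (c ∷ w) ≡ count _≟_ x w
  count-there w c≢x = cong length (filterᵇ-reject _ w (≟-≢ c≢x))

  count-∉ : ∀ {x} w → x ∉ w → count _≟_ x w ≡ 0
  count-∉ []      x∉ = refl
  count-∉ (c ∷ w) x∉ = trans (count-there w (λ c≡x → x∉ (here (sym c≡x)))) (count-∉ w (x∉ ∘ there))

  count-Unique : ∀ {x} w → Unique w → x ∈ w → count _≟_ x w ≡ 1
  count-Unique (c ∷ w) (c∉w ∷ _) (here refl) = trans (count-here c w) (cong suc (count-∉ w (All¬⇒¬Any c∉w)))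
  count-Unique (c ∷ w) (c∉w ∷ u) (there x∈w) =
    trans (count-there w (λ { refl → All¬⇒¬Any c∉w x∈w })) (count-Unique w u x∈w)

  count≡suc⇒∈ : ∀ {x m} w → count _≟_ x w ≡ suc m → x ∈ w
  count≡suc⇒∈ {x} (c ∷ w) eq with toSum (c ≟ x)
  ... | inj₁ c≡x = here (sym c≡x)
  ... | inj₂ c≢x = there (count≡suc⇒∈ w (trans (sym (count-there w c≢x)) eq))

  count-filterᵇ-accept : ∀ p {x} w → p x ≡ true → count _≟_ x (filterᵇ p w) ≡ count _≟_ x w
  count-filterᵇ-accept p {x} w px =
    cong length (filterᵇ-filterᵇ (λ c → does (c ≟ x)) p (λ c c≟x → subst (λ z → p z ≡ true) (sym (≟-true⇒≡ c≟x)) px) w)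

  count-filterᵇ-reject : ∀ p {x} w → p x ≡ false → count _≟_ x (filterᵇ p w) ≡ 0
  count-filterᵇ-reject p w px = count-∉ (filterᵇ p w) (λ x∈ → subst T px (proj₂ (∈-filter⁻ (T? ∘ p) {xs = w} x∈)))

  count-restrict₂ : ∀ x y w → count _≟_ x (restrict₂ _≟_ x y w) ≡ count _≟_ x w
  count-restrict₂ x y w = count-filterᵇ-accept _ w (cong (_∨ does (x ≟ y)) (≟-refl x))

  length-restrict₂ : ∀ {x y} w → x ≢ y → length (restrict₂ _≟_ x y w) ≡ count _≟_ x w + count _≟_ y w
  length-restrict₂ [] x≢y = refl
  length-restrict₂ {x} {y} (c ∷ w) x≢y with toSum (c ≟ x) | toSum (c ≟ y)
  ... | inj₁ refl | inj₁ refl with () ← x≢y refl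
  ... | inj₁ refl | inj₂ c≢y = begin
    length (restrict₂ _≟_ c y (c ∷ w))             ≡⟨ cong length (restrict₂-keepˡ c y w) ⟩
    suc (length (restrict₂ _≟_ c y w))             ≡⟨ cong suc (length-restrict₂ w x≢y) ⟩
    suc (count _≟_ c w + count _≟_ y w)           ≡⟨ cong₂ _+_ (count-here c w) (count-there w c≢y) ⟨
    count _≟_ c (c ∷ w) + count _≟_ y (c ∷ w)     ∎
  ... | inj₂ c≢x | inj₁ refl = begin
    length (restrict₂ _≟_ x c (c ∷ w))             ≡⟨ cong length (restrict₂-keepʳ x c w) ⟩
    suc (length (restrict₂ _≟_ x c w))             ≡⟨ cong suc (length-restrict₂ w x≢y) ⟩
    suc (count _≟_ x w + count _≟_ c w)           ≡⟨ +-suc (count _≟_ x w) _ ⟨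
    count _≟_ x w + suc (count _≟_ c w)           ≡⟨ cong₂ _+_ (count-there w c≢x) (count-here c w) ⟨
    count _≟_ x (c ∷ w) + count _≟_ c (c ∷ w)     ∎
  ... | inj₂ c≢x | inj₂ c≢y = begin
    length (restrict₂ _≟_ x y (c ∷ w))             ≡⟨ cong length (restrict₂-drop w c≢x c≢y) ⟩
    length (restrict₂ _≟_ x y w)                   ≡⟨ length-restrict₂ w x≢y ⟩
    count _≟_ x w + count _≟_ y w                 ≡⟨ cong₂ _+_ (count-there w c≢x) (count-there w c≢y) ⟨
    count _≟_ x (c ∷ w) + count _≟_ y (c ∷ w)     ∎

  restrict₂-without : ∀ x {y} w → y ∉ w → restrict₂ _≟_ x y w ≡ replicate (count _≟_ x w) x
  restrict₂-without x []      y∉ = refl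
  restrict₂-without x (c ∷ w) y∉ with toSum (c ≟ x)
  ... | inj₁ refl = begin
    restrict₂ _≟_ c _ (c ∷ w)         ≡⟨ restrict₂-keepˡ c _ w ⟩
    c ∷ restrict₂ _≟_ c _ w           ≡⟨ cong (c ∷_) (restrict₂-without c w (y∉ ∘ there)) ⟩
    c ∷ replicate (count _≟_ c w) c   ≡⟨ cong (λ m → replicate m c) (count-here c w) ⟨
    replicate (count _≟_ c (c ∷ w)) c ∎
  ... | inj₂ c≢x = begin
    restrict₂ _≟_ x _ (c ∷ w)         ≡⟨ restrict₂-drop w c≢x (λ c≡y → y∉ (here (sym c≡y))) ⟩
    restrict₂ _≟_ x _ w               ≡⟨ restrict₂-without x w (y∉ ∘ there) ⟩
    replicate (count _≟_ x w) x       ≡⟨ cong (λ m → replicate m x) (count-there w c≢x) ⟨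
    replicate (count _≟_ x (c ∷ w)) x ∎

  StartsWith : L → List L → Set
  StartsWith c l = l ≡ [] ⊎ ∃[ l′ ] l ≡ c ∷ l′

  StartsWith-++ : ∀ {c u v} → StartsWith c u → StartsWith c v → StartsWith c (u ++ v)
  StartsWith-++ (inj₁ refl)        sv = sv
  StartsWith-++ (inj₂ (l′ , refl)) _  = inj₂ (_ , refl)

  StartsWith-replicate : ∀ {c} m d → StartsWith c (replicate m c ++ replicate m d)
  StartsWith-replicate zero    d = inj₁ refl
  StartsWith-replicate (suc m) d = inj₂ (_ , refl)

  StartsWith-before : ∀ {c u} v → StartsWith c u → ∃[ w ] u ++ c ∷ v ≡ c ∷ w
  StartsWith-before v (inj₁ refl)        = v , refl
  StartsWith-before v (inj₂ (l′ , refl)) = l′ ++ _ ∷ v , refl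

  count-reverse : ∀ x w → count _≟_ x (reverse w) ≡ count _≟_ x w
  count-reverse x w = trans (cong length (filterᵇ-reverse _ w)) (length-reverse (filterᵇ _ w))

  Alternation : L → L → ℕ → List L → Set
  Alternation x y ℓ u = u ≡ altWord _≟_ x y ℓ ⊎ u ≡ altWord _≟_ y x ℓ

  Alternate-comm : ∀ {x y} w → Alternate _≟_ x y w → Alternate _≟_ y x w
  Alternate-comm {x} {y} w (ℓ , alt) = ℓ , swap (Sum.map (trans (restrict₂-comm y x w)) (trans (restrict₂-comm y x w)) alt)

  length-altWord : ∀ x y ℓ → length (altWord _≟_ x y ℓ) ≡ ℓ
  length-altWord x y zero    = refl
  length-altWord x y (suc ℓ) = cong suc (length-altWord y x ℓ)

  altWord-++ : ∀ x y m ℓ → altWord _≟_ x y (m * 2) ++ altWord _≟_ x y ℓ ≡ altWord _≟_ x y (m * 2 + ℓ)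
  altWord-++ x y zero    ℓ = refl
  altWord-++ x y (suc m) ℓ = cong (λ u → x ∷ y ∷ u) (altWord-++ x y m ℓ)

  count-altWord : ∀ {x y} → x ≢ y → ∀ m → count _≟_ x (altWord _≟_ x y (m * 2)) ≡ m × count _≟_ y (altWord _≟_ x y (m * 2)) ≡ m
  count-altWord x≢y zero    = refl , refl
  count-altWord {x} {y} x≢y (suc m) =
      trans (count-here x _) (cong suc (trans (count-there _ (x≢y ∘ sym)) (proj₁ (count-altWord x≢y m))))
    , trans (count-there _ x≢y) (trans (count-here y _) (cong suc (proj₂ (count-altWord x≢y m))))

  count-Alternation : ∀ {x y u} → x ≢ y → ∀ m → Alternation x y (m * 2) u → count _≟_ x u ≡ m × count _≟_ y u ≡ m
  count-Alternation x≢y m (inj₁ refl) = count-altWord x≢y m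
  count-Alternation x≢y m (inj₂ refl) = Product.swap (count-altWord (x≢y ∘ sym) m)

  altWord-no-repeat : ∀ {x y} → x ≢ y → ∀ ℓ P {c} Q → altWord _≟_ x y ℓ ≢ P ++ c ∷ c ∷ Q
  altWord-no-repeat x≢y (suc (suc ℓ)) []      _ refl = x≢y refl
  altWord-no-repeat x≢y (suc ℓ)       (_ ∷ P) Q eq   = altWord-no-repeat (x≢y ∘ sym) ℓ P _ (proj₂ (∷-injective eq))

  ¬Alternate-repeat : ∀ {x y} w P {c} Q → x ≢ y → restrict₂ _≟_ x y w ≡ P ++ c ∷ c ∷ Q → ¬ Alternate _≟_ x y w
  ¬Alternate-repeat w P Q x≢y eq (ℓ , inj₁ alt) = altWord-no-repeat x≢y ℓ P Q (trans (sym alt) eq)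
  ¬Alternate-repeat w P Q x≢y eq (ℓ , inj₂ alt) = altWord-no-repeat (x≢y ∘ sym) ℓ P Q (trans (sym alt) eq)

  altWord-∷ʳ : ∀ x y m → altWord _≟_ x y (m * 2) ++ x ∷ y ∷ [] ≡ x ∷ y ∷ altWord _≟_ x y (m * 2)
  altWord-∷ʳ x y zero    = refl
  altWord-∷ʳ x y (suc m) = cong (λ u → x ∷ y ∷ u) (altWord-∷ʳ x y m)

  altWord-even-ends : ∀ {x y} → x ≢ y → ∀ m {c} Z → altWord _≟_ x y (suc m * 2) ≢ c ∷ (Z ++ [ c ])
  altWord-even-ends {x} {y} x≢y m {c} Z eq = x≢y (trans x≡c (sym y≡c))
    where
    x≡c : x ≡ c
    x≡c = proj₁ (∷-injective eq)
    y≡c : y ≡ c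
    y≡c = ∷ʳ-injectiveʳ (altWord _≟_ x y (m * 2) ++ [ x ]) (c ∷ Z)
            (trans (++-assoc (altWord _≟_ x y (m * 2)) [ x ] [ y ]) (trans (altWord-∷ʳ x y m) eq))

  ¬Alternate-same-ends : ∀ {x y} w m {c} Z → x ≢ y → length (restrict₂ _≟_ x y w) ≡ suc m * 2 →
                         restrict₂ _≟_ x y w ≡ c ∷ (Z ++ [ c ]) → ¬ Alternate _≟_ x y w
  ¬Alternate-same-ends {x} {y} w m Z x≢y len eq (ℓ , alt) = Sum.[ ends x≢y , ends (x≢y ∘ sym) ] alt
    where
    ends : ∀ {u v} → u ≢ v → restrict₂ _≟_ x y w ≡ altWord _≟_ u v ℓ → ⊥
    ends {u} {v} u≢v alt-uv = altWord-even-ends u≢v m Z (trans (sym alt-uv′) eq)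
      where
      ℓ≡ : ℓ ≡ suc m * 2
      ℓ≡ = trans (sym (length-altWord u v ℓ)) (trans (cong length (sym alt-uv)) len)
      alt-uv′ : restrict₂ _≟_ x y w ≡ altWord _≟_ u v (suc m * 2)
      alt-uv′ = subst (λ n → restrict₂ _≟_ x y w ≡ altWord _≟_ u v n) ℓ≡ alt-uv

  Sandwich : Bool → L → L → List L → Set
  Sandwich β x y R = (β ≡ true × R ≡ x ∷ y ∷ x ∷ []) ⊎ (β ≡ false × (R ≡ y ∷ x ∷ x ∷ [] ⊎ R ≡ x ∷ x ∷ y ∷ []))

  gaps : L → L → ℕ → ℕ → ℕ → List L
  gaps x y c₁ c₂ c₃ = replicate c₁ y ++ x ∷ replicate c₂ y ++ x ∷ replicate c₃ y

  gaps-Sandwich : ∀ {x y} β c₁ c₂ c₃ → c₁ + (c₂ + c₃) ≡ 1 → c₂ ≡ ⟦ β ⟧ → Sandwich β x y (gaps x y c₁ c₂ c₃)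
  gaps-Sandwich true  0 1 0 _ refl = inj₁ (refl , refl)
  gaps-Sandwich false 1 0 0 _ refl = inj₂ (refl , inj₁ refl)
  gaps-Sandwich false 0 0 1 _ refl = inj₂ (refl , inj₂ refl)
  gaps-Sandwich true  0             1 (suc _) () refl
  gaps-Sandwich true  (suc zero)    1 _       () refl
  gaps-Sandwich true  (suc (suc _)) 1 _       () refl

  count-swap : ∀ c u v w → count _≟_ c (u ∷ v ∷ w) ≡ count _≟_ c (v ∷ u ∷ w)
  count-swap c u v w = begin
    count _≟_ c (u ∷ v ∷ w)                                   ≡⟨ count-++ c [ u ] (v ∷ w) ⟩
    count _≟_ c [ u ] + count _≟_ c (v ∷ w)                   ≡⟨ cong (count _≟_ c [ u ] +_) (count-++ c [ v ] w) ⟩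
    count _≟_ c [ u ] + (count _≟_ c [ v ] + count _≟_ c w)   ≡⟨ x∙yz≈y∙xz (count _≟_ c [ u ]) (count _≟_ c [ v ]) (count _≟_ c w) ⟩
    count _≟_ c [ v ] + (count _≟_ c [ u ] + count _≟_ c w)   ≡⟨ cong (count _≟_ c [ v ] +_) (count-++ c [ u ] w) ⟨
    count _≟_ c [ v ] + count _≟_ c (u ∷ w)                   ≡⟨ count-++ c [ v ] (u ∷ w) ⟨
    count _≟_ c (v ∷ u ∷ w)                                   ∎

  count-Sandwich : ∀ {β x y R} → Sandwich β x y R → ∀ c → count _≟_ c R ≡ count _≟_ c (x ∷ y ∷ x ∷ [])
  count-Sandwich (inj₁ (_ , refl))        c = refl
  count-Sandwich (inj₂ (_ , inj₁ refl)) c = count-swap c _ _ _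
  count-Sandwich {x = x} {y} (inj₂ (_ , inj₂ refl)) c =
    trans (count-++ c [ x ] _) (trans (cong (count _≟_ c [ x ] +_) (count-swap c x y [])) (sym (count-++ c [ x ] _)))

  Framed : L → L → ℕ → List L → List L → Set
  Framed x y m R w = ∃[ Pre ] ∃[ Post ] restrict₂ _≟_ x y w ≡ Pre ++ R ++ Post × Alternation x y (m * 2) (Pre ++ x ∷ y ∷ x ∷ Post)

  Framed-count : ∀ {β x y m R} w → x ≢ y → Sandwich β x y R → Framed x y m R w → count _≟_ x w ≡ m × count _≟_ y w ≡ m
  Framed-count {β} {x} {y} {m} {R} w x≢y sandwich (Pre , Post , eq , alt) =
      trans (sym (count-restrict₂ x y w)) (trans (cong (count _≟_ x) eq) (trans (swap-R x) (proj₁ (count-Alternation x≢y m alt))))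
    , trans (sym (count-restrict₂ y x w))
            (trans (cong (count _≟_ y) (trans (restrict₂-comm y x w) eq)) (trans (swap-R y) (proj₂ (count-Alternation x≢y m alt))))
    where
    swap-R : ∀ c → count _≟_ c (Pre ++ R ++ Post) ≡ count _≟_ c (Pre ++ x ∷ y ∷ x ∷ Post)
    swap-R c = begin
      count _≟_ c (Pre ++ R ++ Post)                         ≡⟨ count-++ c Pre _ ⟩
      count _≟_ c Pre + count _≟_ c (R ++ Post)              ≡⟨ cong (count _≟_ c Pre +_) (count-++ c R Post) ⟩
      count _≟_ c Pre + (count _≟_ c R + count _≟_ c Post)   ≡⟨ cong (λ n → count _≟_ c Pre + (n + count _≟_ c Post)) (count-Sandwich sandwich c) ⟩
      count _≟_ c Pre + (count _≟_ c (x ∷ y ∷ x ∷ []) + count _≟_ c Post) ≡⟨ cong (count _≟_ c Pre +_) (count-++ c (x ∷ y ∷ x ∷ []) Post) ⟨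
      count _≟_ c Pre + count _≟_ c (x ∷ y ∷ x ∷ Post)       ≡⟨ count-++ c Pre _ ⟨
      count _≟_ c (Pre ++ x ∷ y ∷ x ∷ Post)                  ∎

  Framed-Alternate : ∀ {β x y m R} w → x ≢ y → Sandwich β x y R → Framed x y m R w → (β ≡ true ⇔ Alternate _≟_ x y w)
  Framed-Alternate w x≢y (inj₁ (refl , refl)) (Pre , Post , eq , alt) = mk⇔ (λ _ → _ , Sum.map (trans eq) (trans eq) alt) (λ _ → refl)
  Framed-Alternate w x≢y (inj₂ (refl , inj₁ refl)) (Pre , Post , eq , alt) =
    mk⇔ (λ ()) (λ alternate → ⊥-elim (¬Alternate-repeat w (Pre ++ [ _ ]) _ x≢y (trans eq (sym (++-assoc Pre [ _ ] _))) alternate))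
  Framed-Alternate w x≢y (inj₂ (refl , inj₂ refl)) (Pre , Post , eq , alt) =
    mk⇔ (λ ()) (λ alternate → ⊥-elim (¬Alternate-repeat w Pre _ x≢y eq alternate))

  concat-applyUpTo-alt : ∀ x y (f : ℕ → List L) m → (∀ u → u < m → f u ≡ x ∷ y ∷ []) → concat (applyUpTo f m) ≡ altWord _≟_ x y (m * 2)
  concat-applyUpTo-alt x y f zero    _  = refl
  concat-applyUpTo-alt x y f (suc m) fu = cong₂ _++_ (fu 0 (s≤s z≤n)) (concat-applyUpTo-alt x y (f ∘ suc) m (λ u u<m → fu (suc u) (s≤s u<m)))

count-map : ∀ {A B : Set} (_≟A_ : DecidableEquality A) (_≟B_ : DecidableEquality B) {f : A → B} →
            (∀ {u v} → f u ≡ f v → u ≡ v) → ∀ x w → count _≟B_ (f x) (map f w) ≡ count _≟A_ x w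
count-map _≟A_ _≟B_ {f} f-inj x []      = refl
count-map _≟A_ _≟B_ {f} f-inj x (c ∷ w) with toSum (c ≟A x)
... | inj₁ refl = trans (B.count-here (f c) (map f w)) (trans (cong suc (count-map _≟A_ _≟B_ f-inj c w)) (sym (A.count-here c w)))
  where module A = Words _≟A_; module B = Words _≟B_
... | inj₂ c≢x = trans (B.count-there (map f w) (c≢x ∘ f-inj)) (trans (count-map _≟A_ _≟B_ f-inj x w) (sym (A.count-there w c≢x)))
  where module A = Words _≟A_; module B = Words _≟B_

count-IsPermOf : ∀ {n} {l : List (Fin n)} {P : Fin n → Set} b → IsPermOf l P → (P? : Dec (P b)) → count Finₚ._≟_ b l ≡ ⟦ does P? ⟧
count-IsPermOf b (unique , l↔P) (yes Pb) = count-Unique _ unique (Equivalence.from (l↔P b) Pb)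
  where open Words Finₚ._≟_
count-IsPermOf b (unique , l↔P) (no ¬Pb) = count-∉ _ (¬Pb ∘ Equivalence.to (l↔P b))
  where open Words Finₚ._≟_

agree : Bool → Bool → Bool → Bool → ℕ
agree β₁ β₂ v₁ v₂ = ⟦ does (β₁ Boolₚ.≟ v₁) ∧ does (β₂ Boolₚ.≟ v₂) ⟧

agree-total : ∀ β₁ β₂ → agree β₁ β₂ false false + (agree β₁ β₂ true false + (agree β₁ β₂ true true + agree β₁ β₂ false true)) ≡ 1
agree-total false false = refl
agree-total false true  = refl
agree-total true  false = refl
agree-total true  true  = refl

agree-fst : ∀ β₁ β₂ → agree β₁ β₂ true false + agree β₁ β₂ true true ≡ ⟦ β₁ ⟧
agree-fst false false = refl
agree-fst false true  = refl
agree-fst true  false = refl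
agree-fst true  true  = refl

agree-snd : ∀ β₁ β₂ → agree β₁ β₂ true true + agree β₁ β₂ false true ≡ ⟦ β₂ ⟧
agree-snd false false = refl
agree-snd false true  = refl
agree-snd true  false = refl
agree-snd true  true  = refl

-- The construction

module Representation {q n : ℕ} (E : Fin (suc (suc q) * 2) → Fin n → Bool) (d : Fin (suc (suc q)) → PairData n)
                      (valid : ∀ s → ValidPairData E (fstA s) (sndA s) (d s)) where

  open Construction d
  open Words (_≟V_ {suc (suc q) * 2} {n})
  private module Fᵏ = Words (Finₚ._≟_ {suc (suc q)})

  k : ℕ
  k = suc (suc q)

  a : Fin k → Fin 2 → Letter
  a s e = inj₁ (combine s e)

  a-injective : ∀ s e t e′ → a s e ≡ a t e′ → s ≡ t × e ≡ e′
  a-injective s e t e′ eq = Finₚ.combine-injective s e t e′ (inj₁-injective eq)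

  a≢b : ∀ s e b → a s e ≢ inj₂ b
  a≢b _ _ _ ()

  a-≢ : ∀ s e t e′ → s ≢ t → a s e ≢ a t e′
  a-≢ s e t e′ s≢t = s≢t ∘ proj₁ ∘ a-injective s e t e′

  a-fst≢snd : ∀ s → a s zero ≢ a s (suc zero)
  a-fst≢snd s eq with () ← proj₂ (a-injective s zero s (suc zero) eq)

  #in : (PairData n → List (Fin n)) → Fin k → Fin n → ℕ
  #in block t b = count Finₚ._≟_ b (block (d t))

  Sides : Fin k → Fin n → Bool → Bool → Set
  Sides t b v₁ v₂ = E (fstA t) b ≡ v₁ × E (sndA t) b ≡ v₂

  sides? : ∀ t b v₁ v₂ → Dec (Sides t b v₁ v₂)
  sides? t b v₁ v₂ = (E (fstA t) b Boolₚ.≟ v₁) ×-dec (E (sndA t) b Boolₚ.≟ v₂)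

  #in-Bi : ∀ t b → #in Bi t b ≡ ⟦ does (sides? t b true false) ⟧
  #in-Bi t b = count-IsPermOf b (proj₁ (valid t)) (sides? t b true false)

  #in-Wmid : ∀ t b → #in Wmid t b ≡ ⟦ does (sides? t b true true) ⟧
  #in-Wmid t b = count-IsPermOf b (proj₁ (proj₂ (valid t))) (sides? t b true true)

  #in-Bj : ∀ t b → #in Bj t b ≡ ⟦ does (sides? t b false true) ⟧
  #in-Bj t b = count-IsPermOf b (proj₁ (proj₂ (proj₂ (valid t)))) (sides? t b false true)

  #in-Bstars : ∀ t b → #in Bstar t b + #in Bstar' t b ≡ ⟦ does (sides? t b false false) ⟧
  #in-Bstars t b = trans (sym (Fⁿ.count-++ b (Bstar (d t)) (Bstar' (d t)))) (count-IsPermOf b (proj₂ (proj₂ (proj₂ (valid t)))) (sides? t b false false))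
    where module Fⁿ = Words (Finₚ._≟_ {n})

  #in-pair : ∀ t b → #in Bstar t b + (#in Bi t b + (#in Wmid t b + (#in Bj t b + #in Bstar' t b))) ≡ 1
  #in-pair t b = begin
    σ + (i + (m + (j + σ′)))  ≡⟨ regroup σ i m j σ′ ⟩
    (σ + σ′) + (i + (m + j))  ≡⟨ cong₂ (λ u v → u + v) (#in-Bstars t b) (cong₂ _+_ (#in-Bi t b) (cong₂ _+_ (#in-Wmid t b) (#in-Bj t b))) ⟩
    agree β₁ β₂ false false + (agree β₁ β₂ true false + (agree β₁ β₂ true true + agree β₁ β₂ false true)) ≡⟨ agree-total β₁ β₂ ⟩
    1                         ∎
    where
    σ = #in Bstar t b; i = #in Bi t b; m = #in Wmid t b; j = #in Bj t b; σ′ = #in Bstar' t b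
    β₁ = E (fstA t) b; β₂ = E (sndA t) b
    regroup : ∀ σ i m j σ′ → σ + (i + (m + (j + σ′))) ≡ (σ + σ′) + (i + (m + j))
    regroup = solve-∀

  #in-fst-gap : ∀ t b → #in Bi t b + #in Wmid t b ≡ ⟦ E (fstA t) b ⟧
  #in-fst-gap t b = trans (cong₂ _+_ (#in-Bi t b) (#in-Wmid t b)) (agree-fst (E (fstA t) b) (E (sndA t) b))

  #in-snd-gap : ∀ t b → #in Wmid t b + #in Bj t b ≡ ⟦ E (sndA t) b ⟧
  #in-snd-gap t b = trans (cong₂ _+_ (#in-Wmid t b) (#in-Bj t b)) (agree-snd (E (fstA t) b) (E (sndA t) b))

  inj₁∉Bs : ∀ {c} l → inj₁ c ∉ Bs l
  inj₁∉Bs l c∈ with ∈-map⁻ inj₂ c∈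
  ... | _ , _ , ()

  restrict-Bs-AB : ∀ c b l → restrict₂ _≟V_ (inj₁ c) (inj₂ b) (Bs l) ≡ replicate (count Finₚ._≟_ b l) (inj₂ b)
  restrict-Bs-AB c b l = begin
    restrict₂ _≟V_ (inj₁ c) (inj₂ b) (Bs l)      ≡⟨ restrict₂-comm _ _ (Bs l) ⟩
    restrict₂ _≟V_ (inj₂ b) (inj₁ c) (Bs l)      ≡⟨ restrict₂-without (inj₂ b) (Bs l) (inj₁∉Bs l) ⟩
    replicate (count _≟V_ (inj₂ b) (Bs l)) (inj₂ b) ≡⟨ cong (λ m → replicate m (inj₂ b)) (count-map Finₚ._≟_ _≟V_ inj₂-injective b l) ⟩
    replicate (count Finₚ._≟_ b l) (inj₂ b)       ∎

  restrict-Bs-AA : ∀ c c′ l → restrict₂ _≟V_ (inj₁ c) (inj₁ c′) (Bs l) ≡ []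
  restrict-Bs-AA c c′ l = trans (restrict₂-without (inj₁ c) (Bs l) (inj₁∉Bs l)) (cong (λ m → replicate m (inj₁ c)) (count-∉ (Bs l) (inj₁∉Bs l)))

  parts : Fin k → List (List Letter)
  parts t = Bs (Bstar (d t)) ∷ [ a t zero ] ∷ Bs (Bi (d t)) ∷ [ a t (suc zero) ] ∷ Bs (Wmid (d t))
          ∷ [ a t zero ] ∷ Bs (Bj (d t)) ∷ [ a t (suc zero) ] ∷ Bs (Bstar' (d t)) ∷ []

  restrict-wPair : ∀ x y t → restrict₂ _≟V_ x y (wPair t) ≡ concat (map (restrict₂ _≟V_ x y) (parts t))
  restrict-wPair x y t = trans (cong (restrict₂ _≟V_ x y) (sym concat-parts)) (filterᵇ-concat _ (parts t))
    where
    concat-parts : concat (parts t) ≡ wPair t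
    concat-parts = cong (λ z → Bs (Bstar (d t)) ++ a t zero ∷ Bs (Bi (d t)) ++ a t (suc zero) ∷ Bs (Wmid (d t))
                                 ++ a t zero ∷ Bs (Bj (d t)) ++ a t (suc zero) ∷ z) (++-identityʳ _)

  restrict-wPair-AA : ∀ c c′ t → let u = restrict₂ _≟V_ (inj₁ c) (inj₁ c′) [ a t zero ]
                                     v = restrict₂ _≟V_ (inj₁ c) (inj₁ c′) [ a t (suc zero) ] in
                      restrict₂ _≟V_ (inj₁ c) (inj₁ c′) (wPair t) ≡ concat (u ∷ v ∷ u ∷ v ∷ [])
  restrict-wPair-AA c c′ t rewrite restrict-wPair (inj₁ c) (inj₁ c′) t | restrict-Bs-AA c c′ (Bstar (d t))
    | restrict-Bs-AA c c′ (Bi (d t)) | restrict-Bs-AA c c′ (Wmid (d t)) | restrict-Bs-AA c c′ (Bj (d t)) | restrict-Bs-AA c c′ (Bstar' (d t)) = refl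

  -- wPair t restricted to b and a letter of A, where u and v are the traces of a t 0 and a t 1
  skeleton : Fin k → Fin n → List Letter → List Letter → List Letter
  skeleton t b u v = concat (replicate (#in Bstar t b) y ∷ u ∷ replicate (#in Bi t b) y ∷ v ∷ replicate (#in Wmid t b) y
                             ∷ u ∷ replicate (#in Bj t b) y ∷ v ∷ replicate (#in Bstar' t b) y ∷ [])
    where y = inj₂ b

  restrict-wPair-AB : ∀ c b t → restrict₂ _≟V_ (inj₁ c) (inj₂ b) (wPair t)
                                ≡ skeleton t b (restrict₂ _≟V_ (inj₁ c) (inj₂ b) [ a t zero ]) (restrict₂ _≟V_ (inj₁ c) (inj₂ b) [ a t (suc zero) ])
  restrict-wPair-AB c b t rewrite restrict-wPair (inj₁ c) (inj₂ b) t | restrict-Bs-AB c b (Bstar (d t))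
    | restrict-Bs-AB c b (Bi (d t)) | restrict-Bs-AB c b (Wmid (d t)) | restrict-Bs-AB c b (Bj (d t)) | restrict-Bs-AB c b (Bstar' (d t)) = refl

  module _ (t : Fin k) (b : Fin n) where
    private
      y : Letter
      y = inj₂ b
      σ i m j σ′ : ℕ
      σ = #in Bstar t b; i = #in Bi t b; m = #in Wmid t b; j = #in Bj t b; σ′ = #in Bstar' t b

    skeleton-fst : ∀ x → skeleton t b [ x ] [] ≡ gaps x y σ (i + m) (j + σ′)
    skeleton-fst x = cong (λ w → replicate σ y ++ x ∷ w)
      (trans (replicate-+-++ i m y _) (cong (λ w → replicate (i + m) y ++ x ∷ w) (trans (replicate-+-++ j σ′ y []) (++-identityʳ _))))

    skeleton-snd : ∀ x → skeleton t b [] [ x ] ≡ gaps x y (σ + i) (m + j) σ′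
    skeleton-snd x = trans (replicate-+-++ σ i y _)
      (cong (λ w → replicate (σ + i) y ++ x ∷ w) (trans (replicate-+-++ m j y _) (cong (λ w → replicate (m + j) y ++ x ∷ w) (++-identityʳ _))))

    gaps-fst-total : σ + ((i + m) + (j + σ′)) ≡ 1
    gaps-fst-total = trans (regroup σ i m j σ′) (#in-pair t b)
      where
      regroup : ∀ σ i m j σ′ → σ + ((i + m) + (j + σ′)) ≡ σ + (i + (m + (j + σ′)))
      regroup = solve-∀

    gaps-snd-total : (σ + i) + ((m + j) + σ′) ≡ 1
    gaps-snd-total = trans (regroup σ i m j σ′) (#in-pair t b)
      where
      regroup : ∀ σ i m j σ′ → (σ + i) + ((m + j) + σ′) ≡ σ + (i + (m + (j + σ′)))
      regroup = solve-∀

    skeleton-none : skeleton t b [] [] ≡ [ y ]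
    skeleton-none = begin
      replicate σ y ++ replicate i y ++ replicate m y ++ replicate j y ++ replicate σ′ y ++ []
        ≡⟨ cong (λ w → replicate σ y ++ replicate i y ++ replicate m y ++ w) (replicate-+-++ j σ′ y []) ⟩
      replicate σ y ++ replicate i y ++ replicate m y ++ replicate (j + σ′) y ++ []
        ≡⟨ cong (λ w → replicate σ y ++ replicate i y ++ w) (replicate-+-++ m (j + σ′) y []) ⟩
      replicate σ y ++ replicate i y ++ replicate (m + (j + σ′)) y ++ []
        ≡⟨ cong (replicate σ y ++_) (replicate-+-++ i (m + (j + σ′)) y []) ⟩
      replicate σ y ++ replicate (i + (m + (j + σ′))) y ++ []
        ≡⟨ replicate-+-++ σ (i + (m + (j + σ′))) y [] ⟩
      replicate (σ + (i + (m + (j + σ′)))) y ++ []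
        ≡⟨ cong (λ c → replicate c y ++ []) (#in-pair t b) ⟩
      [ y ] ∎

  restrict-wPair-other : ∀ s e b t → t ≢ s → restrict₂ _≟V_ (a s e) (inj₂ b) (wPair t) ≡ [ inj₂ b ]
  restrict-wPair-other s e b t t≢s = begin
    restrict₂ _≟V_ (a s e) (inj₂ b) (wPair t)
      ≡⟨ restrict-wPair-AB (combine s e) b t ⟩
    skeleton t b (restrict₂ _≟V_ (a s e) (inj₂ b) [ a t zero ]) (restrict₂ _≟V_ (a s e) (inj₂ b) [ a t (suc zero) ])
      ≡⟨ cong₂ (skeleton t b) (restrict₂-drop [] (a-≢ t zero s e t≢s) λ ()) (restrict₂-drop [] (a-≢ t (suc zero) s e t≢s) λ ()) ⟩
    skeleton t b [] []
      ≡⟨ skeleton-none t b ⟩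
    [ inj₂ b ] ∎

  restrict-wPair-own : ∀ s e b → Sandwich (E (combine s e) b) (a s e) (inj₂ b) (restrict₂ _≟V_ (a s e) (inj₂ b) (wPair s))
  restrict-wPair-own s zero b = subst (Sandwich _ _ _) (sym layout) (gaps-Sandwich _ _ _ _ (gaps-fst-total s b) (#in-fst-gap s b))
    where
    layout : restrict₂ _≟V_ (a s zero) (inj₂ b) (wPair s) ≡ gaps (a s zero) (inj₂ b) (#in Bstar s b) (#in Bi s b + #in Wmid s b) (#in Bj s b + #in Bstar' s b)
    layout = trans (restrict-wPair-AB _ b s)
              (trans (cong₂ (skeleton s b) (restrict₂-keepˡ _ _ []) (restrict₂-drop [] (a-fst≢snd s ∘ sym) λ ())) (skeleton-fst s b _))
  restrict-wPair-own s (suc zero) b = subst (Sandwich _ _ _) (sym layout) (gaps-Sandwich _ _ _ _ (gaps-snd-total s b) (#in-snd-gap s b))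
    where
    layout : restrict₂ _≟V_ (a s (suc zero)) (inj₂ b) (wPair s)
             ≡ gaps (a s (suc zero)) (inj₂ b) (#in Bstar s b + #in Bi s b) (#in Wmid s b + #in Bj s b) (#in Bstar' s b)
    layout = trans (restrict-wPair-AB _ b s)
              (trans (cong₂ (skeleton s b) (restrict₂-drop [] (a-fst≢snd s) λ ()) (restrict₂-keepˡ _ _ [])) (skeleton-snd s b _))

  next : ℕ → ℕ
  next u = if suc u ≡ᵇ k then 0 else suc u

  -- the predicate by which remaining t keeps s, with u = toℕ t
  listed : Fin k → ℕ → Bool
  listed s u = not (toℕ s ≡ᵇ u) ∧ not (toℕ s ≡ᵇ next u)

  count-remaining : ∀ s t → count Finₚ._≟_ s (remaining t) ≡ ⟦ listed s (toℕ t) ⟧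
  count-remaining s t with true-or-false (listed s (toℕ t))
  ... | inj₁ yes-listed = trans (Fᵏ.count-filterᵇ-accept (λ u → listed u (toℕ t)) (allFin k) yes-listed)
                                (trans (Fᵏ.count-Unique (allFin k) (allFin⁺ k) (∈-allFin s)) (cong ⟦_⟧ (sym yes-listed)))
  ... | inj₂ not-listed = trans (Fᵏ.count-filterᵇ-reject (λ u → listed u (toℕ t)) (allFin k) not-listed) (cong ⟦_⟧ (sym not-listed))

  column : Fin 2 → List (Fin k) → List Letter
  column e = map (λ u → a u e)

  count-column-same : ∀ s e l → count _≟V_ (a s e) (column e l) ≡ count Finₚ._≟_ s l
  count-column-same s e = count-map Finₚ._≟_ _≟V_ (λ {u} {v} → proj₁ ∘ a-injective u e v e) s

  column-other : ∀ s {e e′} l → e ≢ e′ → a s e ∉ column e′ l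
  column-other s {e} {e′} l e≢e′ a∈ with ∈-map⁻ (λ u → a u e′) a∈
  ... | u , _ , eq = e≢e′ (proj₂ (a-injective s e u e′ eq))

  inj₂∉column : ∀ {b} e l → inj₂ b ∉ column e l
  inj₂∉column e l b∈ with ∈-map⁻ (λ u → a u e) b∈
  ... | _ , _ , ()

  -- D t unfolds to column 1 ++ column 0 of remaining t
  count-D : ∀ s e t → count _≟V_ (a s e) (D t) ≡ ⟦ listed s (toℕ t) ⟧
  count-D s zero t = begin
    count _≟V_ (a s zero) (column (suc zero) rem ++ column zero rem)                ≡⟨ count-++ _ (column (suc zero) rem) _ ⟩
    count _≟V_ (a s zero) (column (suc zero) rem) + count _≟V_ (a s zero) (column zero rem)
      ≡⟨ cong₂ _+_ (count-∉ _ (column-other s rem λ ())) (count-column-same s zero rem) ⟩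
    count Finₚ._≟_ s rem                                                               ≡⟨ count-remaining s t ⟩
    ⟦ listed s (toℕ t) ⟧                                                              ∎
    where rem = remaining t
  count-D s (suc zero) t = begin
    count _≟V_ (a s (suc zero)) (column (suc zero) rem ++ column zero rem)          ≡⟨ count-++ _ (column (suc zero) rem) _ ⟩
    count _≟V_ (a s (suc zero)) (column (suc zero) rem) + count _≟V_ (a s (suc zero)) (column zero rem)
      ≡⟨ cong₂ _+_ (count-column-same s (suc zero) rem) (count-∉ _ (column-other s rem λ ())) ⟩
    count Finₚ._≟_ s rem + 0                                                           ≡⟨ +-identityʳ _ ⟩
    count Finₚ._≟_ s rem                                                               ≡⟨ count-remaining s t ⟩
    ⟦ listed s (toℕ t) ⟧                                                              ∎
    where rem = remaining t

  inj₂∉D : ∀ {b} t → inj₂ b ∉ D t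
  inj₂∉D t b∈ with ∈-++⁻ (column (suc zero) (remaining t)) b∈
  ... | inj₁ b∈₁ = inj₂∉column (suc zero) (remaining t) b∈₁
  ... | inj₂ b∈₀ = inj₂∉column zero (remaining t) b∈₀

  restrict-D-AB : ∀ s e b t → restrict₂ _≟V_ (a s e) (inj₂ b) (D t) ≡ replicate ⟦ listed s (toℕ t) ⟧ (a s e)
  restrict-D-AB s e b t = trans (restrict₂-without (a s e) (D t) (inj₂∉D t)) (cong (λ m → replicate m (a s e)) (count-D s e t))

  restrict-D-pair : ∀ s t → let c = ⟦ listed s (toℕ t) ⟧ in
                    restrict₂ _≟V_ (a s zero) (a s (suc zero)) (D t) ≡ replicate c (a s (suc zero)) ++ replicate c (a s zero)
  restrict-D-pair s t = begin
    restrict₂ _≟V_ f g (column (suc zero) rem ++ column zero rem)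
      ≡⟨ restrict₂-++ f g (column (suc zero) rem) _ ⟩
    restrict₂ _≟V_ f g (column (suc zero) rem) ++ restrict₂ _≟V_ f g (column zero rem)
      ≡⟨ cong₂ _++_ (trans (restrict₂-comm f g (column (suc zero) rem)) (restrict₂-without g (column (suc zero) rem) (column-other s {zero} rem λ ())))
                     (restrict₂-without f (column zero rem) (column-other s {suc zero} rem λ ())) ⟩
    replicate (count _≟V_ g (column (suc zero) rem)) g ++ replicate (count _≟V_ f (column zero rem)) f
      ≡⟨ cong₂ (λ m m′ → replicate m g ++ replicate m′ f) (trans (count-column-same s _ rem) (count-remaining s t))
                                                          (trans (count-column-same s _ rem) (count-remaining s t)) ⟩
    replicate ⟦ listed s (toℕ t) ⟧ g ++ replicate ⟦ listed s (toℕ t) ⟧ f ∎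
    where
    f g : Letter
    f = a s zero
    g = a s (suc zero)
    rem = remaining t

  pair₂ : Fin k → List Letter
  pair₂ u = a u (suc zero) ∷ a u zero ∷ []

  w0-middle w0-tail : List Letter
  w0-middle = restrictB (reverse (wPair zero))
  w0-tail = concat (map pair₂ (tabulate suc))

  restrict-w0 : ∀ x y → restrict₂ _≟V_ x y w0 ≡ restrict₂ _≟V_ x y (pair₂ zero) ++ restrict₂ _≟V_ x y w0-middle
                                                 ++ restrict₂ _≟V_ x y w0-tail
  restrict-w0 x y = trans (restrict₂-++ x y (pair₂ zero) _) (cong (restrict₂ _≟V_ x y (pair₂ zero) ++_) (restrict₂-++ x y w0-middle _))

  restrict-pairs : ∀ x y {m} (g : Fin m → Fin k) →
                   restrict₂ _≟V_ x y (concat (map pair₂ (tabulate g))) ≡ concat (tabulate (restrict₂ _≟V_ x y ∘ pair₂ ∘ g))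
  restrict-pairs x y g = trans (filterᵇ-concat _ (map pair₂ (tabulate g))) (cong concat (trans (sym (map-∘ (tabulate g))) (map-tabulate g _)))

  restrict-pair₂-other : ∀ x y u → (∀ e → a u e ≢ x) → (∀ e → a u e ≢ y) → restrict₂ _≟V_ x y (pair₂ u) ≡ []
  restrict-pair₂-other x y u ≢x ≢y = trans (restrict₂-drop _ (≢x (suc zero)) (≢y (suc zero))) (restrict₂-drop [] (≢x zero) (≢y zero))

  restrict-pair₂-AB : ∀ s e b → restrict₂ _≟V_ (a s e) (inj₂ b) (pair₂ s) ≡ [ a s e ]
  restrict-pair₂-AB s zero       b = trans (restrict₂-drop _ (a-fst≢snd s ∘ sym) λ ()) (restrict₂-keepˡ _ _ [])
  restrict-pair₂-AB s (suc zero) b = trans (restrict₂-keepˡ (a s (suc zero)) (inj₂ b) [ a s zero ]) (cong (_ ∷_) (restrict₂-drop [] (a-fst≢snd s) λ ()))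

  restrict-pair₂-AA : ∀ s → restrict₂ _≟V_ (a s zero) (a s (suc zero)) (pair₂ s) ≡ pair₂ s
  restrict-pair₂-AA s =
    trans (restrict₂-keepʳ (a s zero) (a s (suc zero)) [ a s zero ]) (cong (a s (suc zero) ∷_) (restrict₂-keepˡ (a s zero) (a s (suc zero)) []))

  inj₁∉restrictB : ∀ {c} w → inj₁ c ∉ restrictB w
  inj₁∉restrictB w c∈ = proj₂ (∈-filter⁻ (T? ∘ isB) {xs = w} c∈)

  restrict-restrictB-AB : ∀ c b w → restrict₂ _≟V_ (inj₁ c) (inj₂ b) (restrictB w) ≡ replicate (count _≟V_ (inj₂ b) w) (inj₂ b)
  restrict-restrictB-AB c b w = begin
    restrict₂ _≟V_ (inj₁ c) (inj₂ b) (restrictB w)         ≡⟨ restrict₂-comm _ _ (restrictB w) ⟩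
    restrict₂ _≟V_ (inj₂ b) (inj₁ c) (restrictB w)         ≡⟨ restrict₂-without (inj₂ b) (restrictB w) (inj₁∉restrictB w) ⟩
    replicate (count _≟V_ (inj₂ b) (restrictB w)) (inj₂ b) ≡⟨ cong (λ m → replicate m (inj₂ b)) (count-filterᵇ-accept isB w refl) ⟩
    replicate (count _≟V_ (inj₂ b) w) (inj₂ b)             ∎

  restrict-restrictB-AA : ∀ c c′ w → restrict₂ _≟V_ (inj₁ c) (inj₁ c′) (restrictB w) ≡ []
  restrict-restrictB-AA c c′ w = trans (restrict₂-without (inj₁ c) (restrictB w) (inj₁∉restrictB w))
                                       (cong (λ m → replicate m (inj₁ c)) (count-∉ (restrictB w) (inj₁∉restrictB w)))

  restrict-restrictB-BB : ∀ b b′ w → restrict₂ _≟V_ (inj₂ b) (inj₂ b′) (restrictB w) ≡ restrict₂ _≟V_ (inj₂ b) (inj₂ b′) w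
  restrict-restrictB-BB b b′ = filterᵇ-filterᵇ _ isB λ { (inj₁ _) () ; (inj₂ _) _ → refl }

  count-wPair-B : ∀ b t → count _≟V_ (inj₂ b) (wPair t) ≡ 1
  count-wPair-B b t = begin
    count _≟V_ y (wPair t)                         ≡⟨ count-restrict₂ y x (wPair t) ⟨
    count _≟V_ y (restrict₂ _≟V_ y x (wPair t))    ≡⟨ cong (count _≟V_ y) (restrict₂-comm y x (wPair t)) ⟩
    count _≟V_ y (restrict₂ _≟V_ x y (wPair t))    ≡⟨ count-Sandwich (restrict-wPair-own t zero b) y ⟩
    count _≟V_ y (x ∷ y ∷ x ∷ [])                  ≡⟨ count-there {y} {x} (y ∷ x ∷ []) (λ ()) ⟩
    count _≟V_ y (y ∷ x ∷ [])                      ≡⟨ count-here y (x ∷ []) ⟩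
    suc (count _≟V_ y (x ∷ []))                    ≡⟨ cong suc (count-there {y} {x} [] (λ ())) ⟩
    1                                              ∎
    where
    x y : Letter
    x = a t zero
    y = inj₂ b

  restrict-w0-middle : ∀ c b → restrict₂ _≟V_ (inj₁ c) (inj₂ b) w0-middle ≡ [ inj₂ b ]
  restrict-w0-middle c b = trans (restrict-restrictB-AB c b (reverse (wPair zero)))
    (cong (λ m → replicate m (inj₂ b)) (trans (count-reverse (inj₂ b) (wPair zero)) (count-wPair-B b zero)))

  restrict-w0-AB-zero : ∀ e b → restrict₂ _≟V_ (a zero e) (inj₂ b) w0 ≡ a zero e ∷ inj₂ b ∷ []
  restrict-w0-AB-zero e b = begin
    restrict₂ _≟V_ x y w0 ≡⟨ restrict-w0 x y ⟩
    restrict₂ _≟V_ x y (pair₂ zero) ++ restrict₂ _≟V_ x y w0-middle ++ restrict₂ _≟V_ x y w0-tail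
      ≡⟨ cong₂ (λ u v → u ++ v ++ restrict₂ _≟V_ x y w0-tail) (restrict-pair₂-AB zero e b) (restrict-w0-middle _ b) ⟩
    x ∷ y ∷ restrict₂ _≟V_ x y w0-tail
      ≡⟨ cong (λ v → x ∷ y ∷ v) (trans (restrict-pairs x y suc)
           (concat-tabulate-[] _ λ u → restrict-pair₂-other x y (suc u) (λ e′ → a-≢ (suc u) e′ zero e λ ()) λ _ ())) ⟩
    x ∷ y ∷ [] ∎
    where
    x y : Letter
    x = a zero e
    y = inj₂ b

  restrict-w0-AB-suc : ∀ s e b → restrict₂ _≟V_ (a (suc s) e) (inj₂ b) w0 ≡ inj₂ b ∷ a (suc s) e ∷ []
  restrict-w0-AB-suc s e b = begin
    restrict₂ _≟V_ x y w0 ≡⟨ restrict-w0 x y ⟩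
    restrict₂ _≟V_ x y (pair₂ zero) ++ restrict₂ _≟V_ x y w0-middle ++ restrict₂ _≟V_ x y w0-tail
      ≡⟨ cong₂ (λ u v → u ++ v ++ restrict₂ _≟V_ x y w0-tail)
               (restrict-pair₂-other x y zero (λ e′ → a-≢ zero e′ (suc s) e λ ()) λ _ ()) (restrict-w0-middle _ b) ⟩
    y ∷ restrict₂ _≟V_ x y w0-tail
      ≡⟨ cong (y ∷_) (trans (restrict-pairs x y suc) (concat-tabulate-single _ s λ u u≢s →
           restrict-pair₂-other x y (suc u) (λ e′ → a-≢ (suc u) e′ (suc s) e (u≢s ∘ Finₚ.suc-injective)) λ _ ())) ⟩
    y ∷ restrict₂ _≟V_ x y (pair₂ (suc s))
      ≡⟨ cong (y ∷_) (restrict-pair₂-AB (suc s) e b) ⟩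
    y ∷ x ∷ [] ∎
    where
    x y : Letter
    x = a (suc s) e
    y = inj₂ b

  next-cases : ∀ u → next u ≡ 0 ⊎ next u ≡ suc u
  next-cases u with suc u ≡ᵇ k
  ... | true  = inj₁ refl
  ... | false = inj₂ refl

  next-inner : ∀ {u} → suc u < k → next u ≡ suc u
  next-inner {u} su<k = cong (if_then 0 else suc u) (≡ᵇ-≢ (<⇒≢ su<k))

  next-last : next (suc q) ≡ 0
  next-last = cong (if_then 0 else suc (suc q)) (≡ᵇ-≡ {suc (suc q)} refl)

  listed-self : ∀ s → listed s (toℕ s) ≡ false
  listed-self s = cong (λ β → not β ∧ not (toℕ s ≡ᵇ next (toℕ s))) (≡ᵇ-≡ {toℕ s} refl)

  listed-pred : ∀ s {u} → next u ≡ toℕ s → listed s u ≡ false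
  listed-pred s {u} next≡s = trans (cong (λ β → not (toℕ s ≡ᵇ u) ∧ not β) (≡ᵇ-≡ (sym next≡s))) (Boolₚ.∧-zeroʳ _)

  listed-other : ∀ s {u} → u ≢ toℕ s → next u ≢ toℕ s → listed s u ≡ true
  listed-other s u≢s next≢s = cong₂ (λ β γ → not β ∧ not γ) (≡ᵇ-≢ (u≢s ∘ sym)) (≡ᵇ-≢ (next≢s ∘ sym))

  trace : Letter → Letter → Fin k → List Letter
  trace x y t = restrict₂ _≟V_ x y (wPair t ++ D t)

  restrict-word : ∀ x y → restrict₂ _≟V_ x y word ≡ concat (tabulate (trace x y)) ++ restrict₂ _≟V_ x y w0
  restrict-word x y = begin
    restrict₂ _≟V_ x y word
      ≡⟨ restrict₂-++ x y (concat (map blocks (allFin k))) w0 ⟩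
    restrict₂ _≟V_ x y (concat (map blocks (allFin k))) ++ restrict₂ _≟V_ x y w0
      ≡⟨ cong (_++ restrict₂ _≟V_ x y w0) (filterᵇ-concat _ (map blocks (allFin k))) ⟩
    concat (map (restrict₂ _≟V_ x y) (map blocks (allFin k))) ++ restrict₂ _≟V_ x y w0
      ≡⟨ cong (λ l → concat l ++ restrict₂ _≟V_ x y w0)
              (trans (sym (map-∘ {g = restrict₂ _≟V_ x y} {f = blocks} (allFin k))) (map-tabulate id (trace x y))) ⟩
    concat (tabulate (trace x y)) ++ restrict₂ _≟V_ x y w0 ∎
    where
    blocks : Fin k → List Letter
    blocks t = wPair t ++ D t

  module _ (s : Fin k) (e : Fin 2) (b : Fin n) where
    private
      x y : Letter
      x = a s e
      y = inj₂ b

    -- trace (a s e) (inj₂ b) t, as a function of u = toℕ t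
    trace-AB : ℕ → List Letter
    trace-AB u = if u ≡ᵇ toℕ s then restrict₂ _≟V_ x y (wPair s) else y ∷ replicate ⟦ listed s u ⟧ x

    trace-AB-own : trace-AB (toℕ s) ≡ restrict₂ _≟V_ x y (wPair s)
    trace-AB-own = cong (if_then restrict₂ _≟V_ x y (wPair s) else y ∷ replicate ⟦ listed s (toℕ s) ⟧ x) (≡ᵇ-≡ {toℕ s} refl)

    trace-AB-other : ∀ {u} → u ≢ toℕ s → trace-AB u ≡ y ∷ replicate ⟦ listed s u ⟧ x
    trace-AB-other {u} u≢s = cong (if_then restrict₂ _≟V_ x y (wPair s) else y ∷ replicate ⟦ listed s u ⟧ x) (≡ᵇ-≢ u≢s)

    trace-AB-yx : ∀ {u} → u ≢ toℕ s → next u ≢ toℕ s → trace-AB u ≡ y ∷ x ∷ []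
    trace-AB-yx u≢s next≢s = trans (trace-AB-other u≢s) (cong (λ β → y ∷ replicate ⟦ β ⟧ x) (listed-other s u≢s next≢s))

    trace-AB-y : ∀ {u} → u ≢ toℕ s → next u ≡ toℕ s → trace-AB u ≡ y ∷ []
    trace-AB-y u≢s next≡s = trans (trace-AB-other u≢s) (cong (λ β → y ∷ replicate ⟦ β ⟧ x) (listed-pred s next≡s))

    trace-AB-toℕ : ∀ t → restrict₂ _≟V_ x y (wPair t ++ D t) ≡ trace-AB (toℕ t)
    trace-AB-toℕ t with toSum (t Finₚ.≟ s)
    ... | inj₁ refl = begin
      restrict₂ _≟V_ x y (wPair s ++ D s)                            ≡⟨ restrict₂-++ x y (wPair s) (D s) ⟩
      restrict₂ _≟V_ x y (wPair s) ++ restrict₂ _≟V_ x y (D s)       ≡⟨ cong (restrict₂ _≟V_ x y (wPair s) ++_) (restrict-D-AB s e b s) ⟩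
      restrict₂ _≟V_ x y (wPair s) ++ replicate ⟦ listed s (toℕ s) ⟧ x
        ≡⟨ cong (λ β → restrict₂ _≟V_ x y (wPair s) ++ replicate ⟦ β ⟧ x) (listed-self s) ⟩
      restrict₂ _≟V_ x y (wPair s) ++ []                             ≡⟨ ++-identityʳ _ ⟩
      restrict₂ _≟V_ x y (wPair s)                                   ≡⟨ trace-AB-own ⟨
      trace-AB (toℕ s)                                               ∎
    ... | inj₂ t≢s = begin
      restrict₂ _≟V_ x y (wPair t ++ D t)                            ≡⟨ restrict₂-++ x y (wPair t) (D t) ⟩
      restrict₂ _≟V_ x y (wPair t) ++ restrict₂ _≟V_ x y (D t)       ≡⟨ cong₂ _++_ (restrict-wPair-other s e b t t≢s) (restrict-D-AB s e b t) ⟩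
      y ∷ replicate ⟦ listed s (toℕ t) ⟧ x                           ≡⟨ trace-AB-other (t≢s ∘ Finₚ.toℕ-injective) ⟨
      trace-AB (toℕ t)                                               ∎

    restrict-word-AB : restrict₂ _≟V_ x y word ≡ concat (applyUpTo trace-AB k) ++ restrict₂ _≟V_ x y w0
    restrict-word-AB = trans (restrict-word x y) (cong (λ l → concat l ++ restrict₂ _≟V_ x y w0) (tabulate-toℕ _ trace-AB trace-AB-toℕ))

  module _ (e : Fin 2) (b : Fin n) where
    private
      x y : Letter
      x = a zero e
      y = inj₂ b
      R : List Letter
      R = restrict₂ _≟V_ x y (wPair zero)
      f : ℕ → List Letter
      f = trace-AB zero e b

    restrict-word-AB-zero : restrict₂ _≟V_ x y word ≡ R ++ altWord _≟V_ y x (q * 2) ++ y ∷ x ∷ y ∷ []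
    restrict-word-AB-zero = begin
      restrict₂ _≟V_ x y word
        ≡⟨ restrict-word-AB zero e b ⟩
      (f 0 ++ concat (applyUpTo (f ∘ suc) (suc q))) ++ restrict₂ _≟V_ x y w0
        ≡⟨ cong₂ (λ u v → (f 0 ++ u) ++ v) (concat-applyUpTo-suc (f ∘ suc) q) (restrict-w0-AB-zero e b) ⟩
      (f 0 ++ (concat (applyUpTo (f ∘ suc) q) ++ f (suc q))) ++ x ∷ y ∷ []
        ≡⟨ cong₂ (λ u w → (u ++ (concat (applyUpTo (f ∘ suc) q) ++ w)) ++ x ∷ y ∷ []) (trace-AB-own zero e b) (trace-AB-y zero e b 1+n≢0 next-last) ⟩
      (R ++ (concat (applyUpTo (f ∘ suc) q) ++ [ y ])) ++ x ∷ y ∷ []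
        ≡⟨ cong (λ v → (R ++ (v ++ [ y ])) ++ x ∷ y ∷ []) middle ⟩
      (R ++ (altWord _≟V_ y x (q * 2) ++ [ y ])) ++ x ∷ y ∷ []
        ≡⟨ ++-assoc R _ _ ⟩
      R ++ ((altWord _≟V_ y x (q * 2) ++ [ y ]) ++ x ∷ y ∷ [])
        ≡⟨ cong (R ++_) (++-assoc (altWord _≟V_ y x (q * 2)) [ y ] _) ⟩
      R ++ altWord _≟V_ y x (q * 2) ++ y ∷ x ∷ y ∷ [] ∎
      where
      middle : concat (applyUpTo (f ∘ suc) q) ≡ altWord _≟V_ y x (q * 2)
      middle = concat-applyUpTo-alt y x (f ∘ suc) q
        (λ u u<q → trace-AB-yx zero e b 1+n≢0 (1+n≢0 ∘ trans (sym (next-inner (s≤s (s≤s u<q))))))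

    framed-AB-zero : Framed x y (suc k) R word
    framed-AB-zero = [] , altWord _≟V_ y x (q * 2) ++ y ∷ x ∷ y ∷ [] , restrict-word-AB-zero , inj₁ alternation
      where
      arith : ∀ q → 3 + (q * 2 + 3) ≡ suc (suc (suc q)) * 2
      arith = solve-∀
      alternation : x ∷ y ∷ x ∷ altWord _≟V_ y x (q * 2) ++ y ∷ x ∷ y ∷ [] ≡ altWord _≟V_ x y (suc k * 2)
      alternation = trans (cong (λ w → x ∷ y ∷ x ∷ w) (altWord-++ y x q 3)) (cong (altWord _≟V_ x y) (arith q))

  module _ (p : Fin (suc q)) (e : Fin 2) (b : Fin n) {r} (p+r≡q : toℕ p + r ≡ q) where
    private
      P : ℕ
      P = toℕ p
      x y : Letter
      x = a (suc p) e
      y = inj₂ b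
      R : List Letter
      R = restrict₂ _≟V_ x y (wPair (suc p))
      f : ℕ → List Letter
      f = trace-AB (suc p) e b
      P≤q : P ≤ q
      P≤q = ≤-pred (Finₚ.toℕ<n p)
      above : ∀ m w → suc (m + w) ≢ m
      above m w = <⇒≢ (s≤s (m≤m+n m w)) ∘ sym

    trace-AB-before : concat (applyUpTo f P) ≡ altWord _≟V_ y x (P * 2)
    trace-AB-before = concat-applyUpTo-alt y x f P λ u u<P →
      let next≡ = next-inner (s≤s (ℕₚ.m<n⇒m<1+n (ℕₚ.<-≤-trans u<P P≤q))) in
      trace-AB-yx (suc p) e b (<⇒≢ (ℕₚ.m<n⇒m<1+n u<P)) (<⇒≢ u<P ∘ ℕₚ.suc-injective ∘ trans (sym next≡))

    trace-AB-after : concat (applyUpTo (λ u → f (suc (suc P) + u)) r) ≡ altWord _≟V_ y x (r * 2)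
    trace-AB-after = concat-applyUpTo-alt y x _ r λ v _ → trace-AB-yx (suc p) e b (above P v ∘ ℕₚ.suc-injective) (next≢ v)
      where
      next≢ : ∀ v → next (suc (suc (P + v))) ≢ suc P
      next≢ v with next-cases (suc (suc (P + v)))
      ... | inj₁ next≡0   = 1+n≢0 ∘ sym ∘ trans (sym next≡0)
      ... | inj₂ next≡suc = above P (suc v) ∘ trans (cong suc (+-suc P v)) ∘ ℕₚ.suc-injective ∘ trans (sym next≡suc)

    restrict-word-AB-suc : restrict₂ _≟V_ x y word ≡ (altWord _≟V_ y x (P * 2) ++ [ y ]) ++ R ++ altWord _≟V_ y x (r * 2) ++ y ∷ x ∷ []
    restrict-word-AB-suc = begin
      restrict₂ _≟V_ x y word
        ≡⟨ restrict-word-AB (suc p) e b ⟩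
      concat (applyUpTo f k) ++ restrict₂ _≟V_ x y w0
        ≡⟨ cong₂ (λ m v → concat (applyUpTo f (suc (suc m))) ++ v) (sym p+r≡q) (restrict-w0-AB-suc p e b) ⟩
      concat (applyUpTo f (suc (suc P) + r)) ++ y ∷ x ∷ []
        ≡⟨ cong (_++ y ∷ x ∷ []) (concat-applyUpTo-+ f (suc (suc P)) r) ⟩
      (concat (applyUpTo f (suc (suc P))) ++ Rest) ++ y ∷ x ∷ []
        ≡⟨ cong (λ w → (w ++ Rest) ++ y ∷ x ∷ []) (trans (concat-applyUpTo-suc f (suc P)) (cong (_++ f (suc P)) (concat-applyUpTo-suc f P))) ⟩
      (((concat (applyUpTo f P) ++ f P) ++ f (suc P)) ++ Rest) ++ y ∷ x ∷ []
        ≡⟨ cong₂ (λ u v → (((u ++ f P) ++ f (suc P)) ++ v) ++ y ∷ x ∷ []) trace-AB-before trace-AB-after ⟩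
      (((altWord _≟V_ y x (P * 2) ++ f P) ++ f (suc P)) ++ altWord _≟V_ y x (r * 2)) ++ y ∷ x ∷ []
        ≡⟨ cong₂ (λ u v → (((altWord _≟V_ y x (P * 2) ++ u) ++ v) ++ altWord _≟V_ y x (r * 2)) ++ y ∷ x ∷ [])
                 (trace-AB-y (suc p) e b (1+n≢n ∘ sym) (next-inner (s≤s (s≤s P≤q)))) (trace-AB-own (suc p) e b) ⟩
      (((altWord _≟V_ y x (P * 2) ++ [ y ]) ++ R) ++ altWord _≟V_ y x (r * 2)) ++ y ∷ x ∷ []
        ≡⟨ ++-assoc ((altWord _≟V_ y x (P * 2) ++ [ y ]) ++ R) _ _ ⟩
      ((altWord _≟V_ y x (P * 2) ++ [ y ]) ++ R) ++ altWord _≟V_ y x (r * 2) ++ y ∷ x ∷ []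
        ≡⟨ ++-assoc (altWord _≟V_ y x (P * 2) ++ [ y ]) R _ ⟩
      (altWord _≟V_ y x (P * 2) ++ [ y ]) ++ R ++ altWord _≟V_ y x (r * 2) ++ y ∷ x ∷ [] ∎
      where
      Rest : List Letter
      Rest = concat (applyUpTo (λ u → f (suc (suc P) + u)) r)

    framed-AB-suc : Framed x y (suc k) R word
    framed-AB-suc = altWord _≟V_ y x (P * 2) ++ [ y ] , altWord _≟V_ y x (r * 2) ++ y ∷ x ∷ [] , restrict-word-AB-suc , inj₂ alternation
      where
      arith : ∀ P r → P * 2 + (4 + (r * 2 + 2)) ≡ suc (suc (suc (P + r))) * 2
      arith = solve-∀
      alternation : (altWord _≟V_ y x (P * 2) ++ [ y ]) ++ x ∷ y ∷ x ∷ altWord _≟V_ y x (r * 2) ++ y ∷ x ∷ [] ≡ altWord _≟V_ y x (suc k * 2)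
      alternation = begin
        (altWord _≟V_ y x (P * 2) ++ [ y ]) ++ x ∷ y ∷ x ∷ altWord _≟V_ y x (r * 2) ++ altWord _≟V_ y x 2
          ≡⟨ ++-assoc (altWord _≟V_ y x (P * 2)) [ y ] _ ⟩
        altWord _≟V_ y x (P * 2) ++ y ∷ x ∷ y ∷ x ∷ altWord _≟V_ y x (r * 2) ++ altWord _≟V_ y x 2
          ≡⟨ cong (λ w → altWord _≟V_ y x (P * 2) ++ y ∷ x ∷ y ∷ x ∷ w) (altWord-++ y x r 2) ⟩
        altWord _≟V_ y x (P * 2) ++ altWord _≟V_ y x (4 + (r * 2 + 2))
          ≡⟨ altWord-++ y x P _ ⟩
        altWord _≟V_ y x (P * 2 + (4 + (r * 2 + 2)))
          ≡⟨ cong (altWord _≟V_ y x) (trans (arith P r) (cong (λ m → suc (suc (suc m)) * 2) p+r≡q)) ⟩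
        altWord _≟V_ y x (suc k * 2) ∎

  framed-AB : ∀ s e b → Framed (a s e) (inj₂ b) (suc k) (restrict₂ _≟V_ (a s e) (inj₂ b) (wPair s)) word
  framed-AB zero    e b = framed-AB-zero e b
  framed-AB (suc p) e b = framed-AB-suc p e b (proj₂ (m≤n⇒∃[o]m+o≡n (≤-pred (Finₚ.toℕ<n p))))

  restrict-D-BB : ∀ b b′ t → restrict₂ _≟V_ (inj₂ b) (inj₂ b′) (D t) ≡ []
  restrict-D-BB b b′ t = trans (restrict₂-without (inj₂ b) (D t) (inj₂∉D t)) (cong (λ m → replicate m (inj₂ b)) (count-∉ (D t) (inj₂∉D t)))

  restrict-w0-AA : ∀ c c′ → restrict₂ _≟V_ (inj₁ c) (inj₁ c′) w0 ≡ concat (tabulate (restrict₂ _≟V_ (inj₁ c) (inj₁ c′) ∘ pair₂))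
  restrict-w0-AA c c′ = begin
    restrict₂ _≟V_ x y w0
      ≡⟨ restrict-w0 x y ⟩
    restrict₂ _≟V_ x y (pair₂ zero) ++ restrict₂ _≟V_ x y w0-middle ++ restrict₂ _≟V_ x y w0-tail
      ≡⟨ cong (λ u → restrict₂ _≟V_ x y (pair₂ zero) ++ u ++ restrict₂ _≟V_ x y w0-tail) (restrict-restrictB-AA c c′ (reverse (wPair zero))) ⟩
    restrict₂ _≟V_ x y (pair₂ zero) ++ restrict₂ _≟V_ x y w0-tail
      ≡⟨ restrict₂-++ x y (pair₂ zero) _ ⟨
    restrict₂ _≟V_ x y (concat (map pair₂ (allFin k)))
      ≡⟨ restrict-pairs x y id ⟩
    concat (tabulate (restrict₂ _≟V_ x y ∘ pair₂)) ∎
    where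
    x y : Letter
    x = inj₁ c
    y = inj₁ c′

  module _ (s : Fin k) where
    private
      f g : Letter
      f = a s zero
      g = a s (suc zero)

    trace-pair-own : trace f g s ≡ f ∷ g ∷ f ∷ g ∷ []
    trace-pair-own = begin
      restrict₂ _≟V_ f g (wPair s ++ D s)                      ≡⟨ restrict₂-++ f g (wPair s) (D s) ⟩
      restrict₂ _≟V_ f g (wPair s) ++ restrict₂ _≟V_ f g (D s) ≡⟨ cong₂ _++_ (restrict-wPair-AA _ _ s) (restrict-D-pair s s) ⟩
      concat (u ∷ v ∷ u ∷ v ∷ []) ++ replicate c g ++ replicate c f
        ≡⟨ computed ⟩
      (f ∷ g ∷ f ∷ g ∷ []) ++ [] ++ []                         ≡⟨⟩
      f ∷ g ∷ f ∷ g ∷ []                                       ∎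
      where
      u v : List Letter
      u = restrict₂ _≟V_ f g [ f ]
      v = restrict₂ _≟V_ f g [ g ]
      c = ⟦ listed s (toℕ s) ⟧
      computed : concat (u ∷ v ∷ u ∷ v ∷ []) ++ replicate c g ++ replicate c f ≡ (f ∷ g ∷ f ∷ g ∷ []) ++ [] ++ []
      computed rewrite restrict₂-keepˡ f g [] | restrict₂-keepʳ f g [] | listed-self s = refl

    trace-pair-other : ∀ t → t ≢ s → StartsWith g (trace f g t)
    trace-pair-other t t≢s = subst (StartsWith g) (sym trace-t) (StartsWith-replicate ⟦ listed s (toℕ t) ⟧ f)
      where
      dropped : ∀ e → restrict₂ _≟V_ f g [ a t e ] ≡ []
      dropped e = restrict₂-drop [] (a-≢ t e s zero t≢s) (a-≢ t e s (suc zero) t≢s)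
      trace-t : trace f g t ≡ replicate ⟦ listed s (toℕ t) ⟧ g ++ replicate ⟦ listed s (toℕ t) ⟧ f
      trace-t = begin
        restrict₂ _≟V_ f g (wPair t ++ D t)                      ≡⟨ restrict₂-++ f g (wPair t) (D t) ⟩
        restrict₂ _≟V_ f g (wPair t) ++ restrict₂ _≟V_ f g (D t) ≡⟨ cong₂ _++_ (restrict-wPair-AA _ _ t) (restrict-D-pair s t) ⟩
        concat (u ∷ v ∷ u ∷ v ∷ []) ++ replicate ⟦ listed s (toℕ t) ⟧ g ++ replicate ⟦ listed s (toℕ t) ⟧ f
          ≡⟨ cong₂ (λ u v → concat (u ∷ v ∷ u ∷ v ∷ []) ++ replicate ⟦ listed s (toℕ t) ⟧ g ++ replicate ⟦ listed s (toℕ t) ⟧ f)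
                   (dropped zero) (dropped (suc zero)) ⟩
        replicate ⟦ listed s (toℕ t) ⟧ g ++ replicate ⟦ listed s (toℕ t) ⟧ f ∎
        where
        u v : List Letter
        u = restrict₂ _≟V_ f g [ a t zero ]
        v = restrict₂ _≟V_ f g [ a t (suc zero) ]

    restrict-w0-pair : restrict₂ _≟V_ f g w0 ≡ g ∷ f ∷ []
    restrict-w0-pair = begin
      restrict₂ _≟V_ f g w0                               ≡⟨ restrict-w0-AA (fstA s) (sndA s) ⟩
      concat (tabulate (restrict₂ _≟V_ f g ∘ pair₂))      ≡⟨ concat-tabulate-single _ s other ⟩
      restrict₂ _≟V_ f g (pair₂ s)                         ≡⟨ restrict-pair₂-AA s ⟩
      g ∷ f ∷ []                                           ∎
      where
      other : ∀ u → u ≢ s → restrict₂ _≟V_ f g (pair₂ u) ≡ []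
      other u u≢s = restrict-pair₂-other f g u (λ e → a-≢ u e s zero u≢s) (λ e → a-≢ u e s (suc zero) u≢s)

    ¬Alternate-pair : ¬ Alternate _≟V_ f g word
    ¬Alternate-pair with concat-tabulate-split (StartsWith g) (inj₁ refl) StartsWith-++ (trace f g) s trace-pair-other
    ... | Pre , Post , _ , starts , split with StartsWith-before (f ∷ []) starts
    ... | Z , Post-g = ¬Alternate-repeat word (Pre ++ f ∷ g ∷ f ∷ []) Z (a-fst≢snd s) (begin
      restrict₂ _≟V_ f g word                                   ≡⟨ restrict-word f g ⟩
      concat (tabulate (trace f g)) ++ restrict₂ _≟V_ f g w0 ≡⟨ cong₂ _++_ split restrict-w0-pair ⟩
      (Pre ++ trace f g s ++ Post) ++ g ∷ f ∷ []           ≡⟨ cong (λ w → (Pre ++ w ++ Post) ++ g ∷ f ∷ []) trace-pair-own ⟩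
      (Pre ++ f ∷ g ∷ f ∷ g ∷ Post) ++ g ∷ f ∷ []               ≡⟨ ++-assoc Pre _ _ ⟩
      Pre ++ f ∷ g ∷ f ∷ g ∷ Post ++ g ∷ f ∷ []                 ≡⟨ cong (λ w → Pre ++ f ∷ g ∷ f ∷ g ∷ w) Post-g ⟩
      Pre ++ f ∷ g ∷ f ∷ g ∷ g ∷ Z                              ≡⟨ ++-assoc Pre (f ∷ g ∷ f ∷ []) _ ⟨
      (Pre ++ f ∷ g ∷ f ∷ []) ++ g ∷ g ∷ Z                      ∎)

  restrict-wPair-apart : ∀ s e t e′ → s ≢ t → restrict₂ _≟V_ (a s e) (a t e′) (wPair s) ≡ a s e ∷ a s e ∷ []
  restrict-wPair-apart s zero t e′ s≢t = trans (restrict-wPair-AA _ _ s)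
    (cong₂ (λ u v → concat (u ∷ v ∷ u ∷ v ∷ [])) (restrict₂-keepˡ _ (a t e′) []) (restrict₂-drop [] (a-fst≢snd s ∘ sym) (a-≢ s (suc zero) t e′ s≢t)))
  restrict-wPair-apart s (suc zero) t e′ s≢t = trans (restrict-wPair-AA _ _ s)
    (cong₂ (λ u v → concat (u ∷ v ∷ u ∷ v ∷ [])) (restrict₂-drop [] (a-fst≢snd s) (a-≢ s zero t e′ s≢t)) (restrict₂-keepˡ _ (a t e′) []))

  ¬Alternate-apart : ∀ s e t e′ → s ≢ t → ¬ Alternate _≟V_ (a s e) (a t e′) word
  ¬Alternate-apart s e t e′ s≢t with concat-tabulate-split (λ _ → ⊤) tt (λ _ _ → tt) (trace x y) s (λ _ _ → tt)
    where
    x y : Letter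
    x = a s e
    y = a t e′
  ... | Pre , Post , _ , _ , split = ¬Alternate-repeat word Pre _ (a-≢ s e t e′ s≢t) (begin
    restrict₂ _≟V_ x y word                                       ≡⟨ restrict-word x y ⟩
    concat (tabulate (trace x y)) ++ restrict₂ _≟V_ x y w0   ≡⟨ cong (_++ restrict₂ _≟V_ x y w0) split ⟩
    (Pre ++ trace x y s ++ Post) ++ restrict₂ _≟V_ x y w0    ≡⟨ ++-assoc Pre _ _ ⟩
    Pre ++ (trace x y s ++ Post) ++ restrict₂ _≟V_ x y w0
      ≡⟨ cong (λ w → Pre ++ (w ++ Post) ++ restrict₂ _≟V_ x y w0)
              (trans (restrict₂-++ x y (wPair s) (D s)) (cong (_++ restrict₂ _≟V_ x y (D s)) (restrict-wPair-apart s e t e′ s≢t))) ⟩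
    Pre ++ x ∷ x ∷ (restrict₂ _≟V_ x y (D s) ++ Post) ++ restrict₂ _≟V_ x y w0 ∎)
    where
    x y : Letter
    x = a s e
    y = a t e′

  count-A : ∀ s e (b : Fin n) → count _≟V_ (a s e) word ≡ suc k
  count-A s e b = proj₁ (Framed-count word (a≢b s e b) (restrict-wPair-own s e b) (framed-AB s e b))

  count-B : ∀ b → count _≟V_ (inj₂ b) word ≡ suc k
  count-B b = proj₂ (Framed-count word (a≢b zero zero b) (restrict-wPair-own zero zero b) (framed-AB zero zero b))

  restrict-w0-BB : ∀ b b′ → restrict₂ _≟V_ (inj₂ b) (inj₂ b′) w0 ≡ reverse (restrict₂ _≟V_ (inj₂ b) (inj₂ b′) (wPair zero))
  restrict-w0-BB b b′ = begin
    restrict₂ _≟V_ x y w0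
      ≡⟨ restrict-w0 x y ⟩
    restrict₂ _≟V_ x y (pair₂ zero) ++ restrict₂ _≟V_ x y w0-middle ++ restrict₂ _≟V_ x y w0-tail
      ≡⟨ cong₂ (λ u v → u ++ restrict₂ _≟V_ x y w0-middle ++ v) (restrict-pair₂-other x y zero (λ _ ()) (λ _ ()))
               (trans (restrict-pairs x y suc) (concat-tabulate-[] _ λ u → restrict-pair₂-other x y (suc u) (λ _ ()) (λ _ ()))) ⟩
    restrict₂ _≟V_ x y w0-middle ++ []
      ≡⟨ ++-identityʳ _ ⟩
    restrict₂ _≟V_ x y w0-middle
      ≡⟨ restrict-restrictB-BB b b′ (reverse (wPair zero)) ⟩
    restrict₂ _≟V_ x y (reverse (wPair zero))
      ≡⟨ filterᵇ-reverse _ (wPair zero) ⟩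
    reverse (restrict₂ _≟V_ x y (wPair zero)) ∎
    where
    x y : Letter
    x = inj₂ b
    y = inj₂ b′

  ¬Alternate-B : ∀ {b b′} → b ≢ b′ → ¬ Alternate _≟V_ (inj₂ b) (inj₂ b′) word
  ¬Alternate-B {b} {b′} b≢b′ with restrict₂ _≟V_ (inj₂ b) (inj₂ b′) (wPair zero) in R≡ | count-restrict₂ (inj₂ b) (inj₂ b′) (wPair zero)
  ... | [] | count≡ with () ← trans count≡ (count-wPair-B b zero)
  ... | c ∷ R | _ = ¬Alternate-same-ends word k Z (b≢b′ ∘ inj₂-injective) length-even (begin
    restrict₂ _≟V_ x y word                                                   ≡⟨ restrict-word x y ⟩
    (trace x y zero ++ M) ++ restrict₂ _≟V_ x y w0
      ≡⟨ cong₂ (λ u v → (u ++ M) ++ v) first (trans (restrict-w0-BB b b′) (cong reverse R≡)) ⟩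
    ((c ∷ R) ++ M) ++ reverse (c ∷ R)                                          ≡⟨ cong (((c ∷ R) ++ M) ++_) (unfold-reverse c R) ⟩
    ((c ∷ R) ++ M) ++ reverse R ++ [ c ]                                       ≡⟨ ++-assoc ((c ∷ R) ++ M) (reverse R) [ c ] ⟨
    c ∷ Z ++ [ c ]                                                            ∎)
    where
    x y : Letter
    x = inj₂ b
    y = inj₂ b′
    M = concat (tabulate (trace x y ∘ suc))
    Z = (R ++ M) ++ reverse R
    first : trace x y zero ≡ c ∷ R
    first = trans (restrict₂-++ x y (wPair zero) (D zero)) (trans (cong₂ _++_ R≡ (restrict-D-BB b b′ zero)) (++-identityʳ _))
    length-even : length (restrict₂ _≟V_ x y word) ≡ suc k * 2
    length-even = trans (length-restrict₂ word (b≢b′ ∘ inj₂-injective)) (trans (cong₂ _+_ (count-B b) (count-B b′)) (double (suc k)))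
      where
      double : ∀ m → m + m ≡ m * 2
      double = solve-∀

  data PairView : Fin (k * 2) → Set where
    pairOf : (s : Fin k) (e : Fin 2) → PairView (combine s e)

  pairView : ∀ c → PairView c
  pairView c = subst PairView (Finₚ.combine-remQuot {k} 2 c) (pairOf (proj₁ (remQuot {k} 2 c)) (proj₂ (remQuot {k} 2 c)))

  ¬Alternate-A : ∀ s e t e′ → a s e ≢ a t e′ → ¬ Alternate _≟V_ (a s e) (a t e′) word
  ¬Alternate-A s e t e′ x≢y with toSum (s Finₚ.≟ t)
  ... | inj₂ s≢t = ¬Alternate-apart s e t e′ s≢t
  ¬Alternate-A s zero       .s zero       x≢y | inj₁ refl = ⊥-elim (x≢y refl)
  ¬Alternate-A s zero       .s (suc zero) x≢y | inj₁ refl = ¬Alternate-pair s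
  ¬Alternate-A s (suc zero) .s zero       x≢y | inj₁ refl = ¬Alternate-pair s ∘ Alternate-comm word
  ¬Alternate-A s (suc zero) .s (suc zero) x≢y | inj₁ refl = ⊥-elim (x≢y refl)

  adjacent⇔alternate-AB : ∀ s e b → E (combine s e) b ≡ true ⇔ Alternate _≟V_ (a s e) (inj₂ b) word
  adjacent⇔alternate-AB s e b = Framed-Alternate {m = suc k} word (a≢b s e b) (restrict-wPair-own s e b) (framed-AB s e b)

  adjacent⇔alternate : ∀ x y → x ≢ y → BAdj E x y ⇔ Alternate _≟V_ x y word
  adjacent⇔alternate (inj₁ c) (inj₂ b) _ with pairView c
  ... | pairOf s e = adjacent⇔alternate-AB s e b
  adjacent⇔alternate (inj₂ b) (inj₁ c) _ with pairView c
  ... | pairOf s e = mk⇔ (Alternate-comm word ∘ Equivalence.to (adjacent⇔alternate-AB s e b))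
                         (Equivalence.from (adjacent⇔alternate-AB s e b) ∘ Alternate-comm word)
  adjacent⇔alternate (inj₁ c) (inj₁ c′) c≢c′ with pairView c | pairView c′
  ... | pairOf s e | pairOf t e′ = mk⇔ ⊥-elim (¬Alternate-A s e t e′ c≢c′)
  adjacent⇔alternate (inj₂ b) (inj₂ b′) b≢b′ = mk⇔ ⊥-elim (¬Alternate-B (b≢b′ ∘ cong inj₂))

  uniform : Fin n → Uniform _≟V_ (suc k) word
  uniform b₀ (inj₁ c) with pairView c
  ... | pairOf s e = count-A s e b₀
  uniform b₀ (inj₂ b) = count-B b

  represents : Fin n → Represents _≟V_ (BAdj E) word × Uniform _≟V_ (suc k) word
  represents b₀ = ((λ v → count≡suc⇒∈ word (uniform b₀ v)) , adjacent⇔alternate) , uniform b₀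

at-least-two-pairs : ∀ {m} k → 3 ≤ m → m ≡ k * 2 ⊎ suc m ≡ k * 2 → 2 ≤ k
at-least-two-pairs (suc (suc k)) _                   _         = s≤s (s≤s z≤n)
at-least-two-pairs zero          (s≤s _)             (inj₁ ())
at-least-two-pairs zero          _                   (inj₂ ())
at-least-two-pairs (suc zero)    (s≤s (s≤s (s≤s _))) (inj₁ ())
at-least-two-pairs (suc zero)    (s≤s (s≤s _))       (inj₂ ())

theorem1 : (m n k : ℕ) (E : Fin m → Fin n → Bool)
    → 3 ≤ m → m ≤ n
    → Connected E → Reduced E
    → (m ≡ k * 2 ⊎ suc m ≡ k * 2)
    → (d : Fin k → PairData n)
    → (∀ s → ValidPairData (extend k E) (fstA s) (sndA s) (d s))
    → Represents _≟V_ (BAdj (extend k E)) (Construction.word d)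
    × Uniform _≟V_ (suc k) (Construction.word d)
theorem1 m n k E 3≤m m≤n _ _ m≈2k d valid with at-least-two-pairs k 3≤m m≈2k | ℕₚ.≤-trans 3≤m m≤n
... | s≤s (s≤s z≤n) | s≤s _ = Representation.represents (extend k E) d valid zero
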